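{- Let $n$ be a positive integer and let $a,r,s$ be non-negative integers with $a\leqslant n$. Then $$ \sum_{k=a}^{n}q^{ -(2r+1)k}[2k+1]^{2r+1} {2n+1\brack n-k}(q^{ -k};q)_s (q^{k+1};q)_s \equiv 0\pmod{[2n+1]{2n\brack n-a}}. $$
   Context: $q$ is an indeterminate, $[n]=\frac{1-q^n}{1-q}$, $(x;q)_0=1$ and $(x;q)_s=(1-x)(1-xq)\cdots(1-xq^{s-1})$, and ${n\brack k}=\frac{(q;q)_n}{(q;q)_k(q;q)_{n-k}}$ for $0\leqslant k\leqslant n$, $0$ otherwise. For a Laurent polynomial $P(q)$ and a polynomial $D(q)$, $P(q)\equiv 0\pmod{D(q)}$ means that $P(q)/D(q)$ is a Laurent polynomial in $q$. -}

module Defs where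

open import Data.Nat using (ℕ; zero; suc; _∸_) renaming (_+_ to _+ℕ_; _*_ to _*ℕ_)
open import Data.Integer using (ℤ; +_; -[1+_]) renaming (_+_ to _+ℤ_; _*_ to _*ℤ_)
open import Data.List using (List; []; _∷_; replicate; _++_; map)
open import Data.Product using (Σ)
open import Relation.Binary.PropositionalEquality using (_≡_)

-- Polynomials in q with integer coefficients: coefficient lists,
-- lowest degree first.  Equality is coefficientwise (so trailing
-- zeros are irrelevant).

Poly : Set
Poly = List ℤ

coeff : Poly → ℕ → ℤ
coeff []       _       = + 0
coeff (c ∷ _)  zero    = c
coeff (_ ∷ cs) (suc i) = coeff cs i

_≈P_ : Poly → Poly → Set
p ≈P p′ = ∀ i → coeff p i ≡ coeff p′ i

addP : Poly → Poly → Poly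
addP []       ys       = ys
addP xs       []       = xs
addP (x ∷ xs) (y ∷ ys) = (x +ℤ y) ∷ addP xs ys

scaleP : ℤ → Poly → Poly
scaleP c = map (c *ℤ_)

mulP : Poly → Poly → Poly
mulP []       _  = []
mulP (x ∷ xs) ys = addP (scaleP x ys) (+ 0 ∷ mulP xs ys)

shiftP : ℕ → Poly → Poly
shiftP m p = replicate m (+ 0) ++ p

powP : Poly → ℕ → Poly
powP p zero    = + 1 ∷ []
powP p (suc m) = mulP p (powP p m)

-- Laurent polynomials: a pair (e , p) stands for q^{-e} · p(q).

record Laurent : Set where
  constructor _/q^_
  field
    num : Poly
    den : ℕ
open Laurent public

_≈L_ : Laurent → Laurent → Set
(p /q^ e) ≈L (p′ /q^ e′) = shiftP e′ p ≈P shiftP e p′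

fromPoly : Poly → Laurent
fromPoly p = p /q^ 0

_+L_ : Laurent → Laurent → Laurent
(p /q^ e) +L (p′ /q^ e′) = addP (shiftP e′ p) (shiftP e p′) /q^ (e +ℕ e′)

_*L_ : Laurent → Laurent → Laurent
(p /q^ e) *L (p′ /q^ e′) = mulP p p′ /q^ (e +ℕ e′)

negL : Laurent → Laurent
negL (p /q^ e) = scaleP (-[1+ 0 ]) p /q^ e

zeroL oneL : Laurent
zeroL = [] /q^ 0
oneL  = (+ 1 ∷ []) /q^ 0

qPow : ℤ → Laurent
qPow (+ m)     = shiftP m (+ 1 ∷ []) /q^ 0
qPow -[1+ m ]  = (+ 1 ∷ []) /q^ (suc m)

sumL : ℕ → (ℕ → Laurent) → Laurent
sumL zero    f = zeroL
sumL (suc m) f = sumL m f +L f m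

prodL : ℕ → (ℕ → Laurent) → Laurent
prodL zero    f = oneL
prodL (suc m) f = prodL m f *L f m

-- ∑_{k = a}^{n} f k   (empty if n < a)
sumFromTo : ℕ → ℕ → (ℕ → Laurent) → Laurent
sumFromTo a n f = sumL (suc n ∸ a) (λ i → f (a +ℕ i))

-- [n] = (1 - q^n)/(1 - q) = 1 + q + ... + q^{n-1}
qInt : ℕ → Poly
qInt n = replicate n (+ 1)

qPoch : Laurent → ℕ → Laurent
qPoch x s = prodL s (λ j → oneL +L negL (x *L qPow (+ j)))

-- Gaussian binomial coefficient [n brack k] (0 unless 0 ≤ k ≤ n),
-- computed by the q-Pascal rule
--   [n+1 brack k+1] = [n brack k] + q^{k+1} [n brack k+1].
qBin : ℕ → ℕ → Poly
qBin zero    zero    = + 1 ∷ []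
qBin zero    (suc k) = []
qBin (suc n) zero    = + 1 ∷ []
qBin (suc n) (suc k) = addP (qBin n k) (shiftP (suc k) (qBin n (suc k)))

-- P ≡ 0 (mod D): P / D is a Laurent polynomial, i.e. P = D · L for
-- some Laurent polynomial L.

DividesL : Poly → Laurent → Set
DividesL D P = Σ Laurent (λ L → P ≈L (fromPoly D *L L))

module Submission where

-- Put u k = q^{-k}[2k+1] and y j k = q^{-k}([j] - [k])[j+k+1]; then
-- (q^{-k};q)_s (q^{k+1};q)_s = (1-q)^{2s} R s k with R s k = ∏_{j<s} y j k,
-- and the summand is (1-q)^{2s} u k [2n+1 brack n-k] (u k²)^r R s k.  Call a
-- weight f admissible if ∑_{k=a}^{n} u k [2n+1 brack n-k] f k is divisible
-- by [2n+1][2n brack n-a] for all a ≤ n.  Then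
--  * R 0 = 1 is admissible: the sum telescopes to q^{-n}[2n+1][2n brack n-a];
--  * if R s is admissible so is R (s+1): recentring y s k at the upper limit n
--    leaves R s plus a sum weighted by y n k · R s k, whose top term vanishes
--    and whose other terms are [2n+1][2n] times those for n - 1 (absorption
--    of Gaussian binomials);
--  * u k² = 1 - 2(1+q) y 0 k + (1-q)² (y 0 k)², and y 0 k · R s k is a fixed
--    combination of R (s+1) k and R s k, so (u k²)^r R s is admissible.

open import Defs

module Polynomial where

  open import Data.Nat using (ℕ; zero; suc) renaming (_+_ to _+ℕ_)
  open import Data.Integer using (ℤ; +_; -[1+_]) renaming (_+_ to _+ℤ_; _*_ to _*ℤ_)
  import Data.Integer.Properties as ℤ
  open import Data.Integer.Tactic.RingSolver using (solve-∀)
  open import Data.List using ([]; _∷_)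
  open import Relation.Binary.PropositionalEquality
  open ≡-Reasoning

  -- Coefficientwise equality, wrapped in a record so that the two
  -- polynomials can be inferred from an equality proof.
  infix 4 _≋_
  record _≋_ (p r : Poly) : Set where
    constructor mk
    field at : p ≈P r
  open _≋_ public

  ≋-refl : ∀ {p} → p ≋ p
  ≋-refl = mk λ _ → refl

  ≋-sym : ∀ {p r} → p ≋ r → r ≋ p
  ≋-sym e = mk λ i → sym (at e i)

  ≋-trans : ∀ {p r t} → p ≋ r → r ≋ t → p ≋ t
  ≋-trans e f = mk λ i → trans (at e i) (at f i)

  ≋-reflexive : ∀ {p r} → p ≡ r → p ≋ r
  ≋-reflexive refl = ≋-refl

  ∷-cong : ∀ {x y xs ys} → x ≡ y → xs ≋ ys → (x ∷ xs) ≋ (y ∷ ys)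
  ∷-cong x≡y e = mk λ { zero → x≡y ; (suc i) → at e i }

  ∷-zero : ∀ {xs} → xs ≋ [] → (+ 0 ∷ xs) ≋ []
  ∷-zero e = mk λ { zero → refl ; (suc i) → at e i }

  ∷-head : ∀ {x y xs ys} → (x ∷ xs) ≋ (y ∷ ys) → x ≡ y
  ∷-head e = at e zero

  ∷-tail : ∀ {x y xs ys} → (x ∷ xs) ≋ (y ∷ ys) → xs ≋ ys
  ∷-tail e = mk λ i → at e (suc i)

  ∷-head-zero : ∀ {x xs} → (x ∷ xs) ≋ [] → x ≡ + 0
  ∷-head-zero e = at e zero

  ∷-tail-zero : ∀ {x xs} → (x ∷ xs) ≋ [] → xs ≋ []
  ∷-tail-zero e = mk λ i → at e (suc i)

  coeff↑ : Poly → ℕ → ℤ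
  coeff↑ p zero    = + 0
  coeff↑ p (suc i) = coeff p i

  coeff-nil↑ : ∀ i → coeff↑ [] i ≡ + 0
  coeff-nil↑ zero    = refl
  coeff-nil↑ (suc i) = refl

  coeff-↑ : ∀ p i → coeff (+ 0 ∷ p) i ≡ coeff↑ p i
  coeff-↑ p zero    = refl
  coeff-↑ p (suc i) = refl

  coeff↑-cong : ∀ {p r} → p ≋ r → ∀ i → coeff↑ p i ≡ coeff↑ r i
  coeff↑-cong e zero    = refl
  coeff↑-cong e (suc i) = at e i

  coeff-add : ∀ p r i → coeff (addP p r) i ≡ coeff p i +ℤ coeff r i
  coeff-add []       r        i       = sym (ℤ.+-identityˡ _)
  coeff-add (x ∷ xs) []       i       = sym (ℤ.+-identityʳ _)
  coeff-add (x ∷ xs) (y ∷ ys) zero    = refl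
  coeff-add (x ∷ xs) (y ∷ ys) (suc i) = coeff-add xs ys i

  coeff↑-add : ∀ p r i → coeff↑ (addP p r) i ≡ coeff↑ p i +ℤ coeff↑ r i
  coeff↑-add p r zero    = refl
  coeff↑-add p r (suc i) = coeff-add p r i

  coeff-scale : ∀ c p i → coeff (scaleP c p) i ≡ c *ℤ coeff p i
  coeff-scale c []       i       = sym (ℤ.*-zeroʳ c)
  coeff-scale c (x ∷ xs) zero    = refl
  coeff-scale c (x ∷ xs) (suc i) = coeff-scale c xs i

  coeff↑-scale : ∀ c p i → coeff↑ (scaleP c p) i ≡ c *ℤ coeff↑ p i
  coeff↑-scale c p zero    = sym (ℤ.*-zeroʳ c)
  coeff↑-scale c p (suc i) = coeff-scale c p i

  coeff-mul : ∀ x xs ys i →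
    coeff (mulP (x ∷ xs) ys) i ≡ x *ℤ coeff ys i +ℤ coeff↑ (mulP xs ys) i
  coeff-mul x xs ys i = trans (coeff-add (scaleP x ys) (+ 0 ∷ mulP xs ys) i)
    (cong₂ _+ℤ_ (coeff-scale x ys i) (coeff-↑ (mulP xs ys) i))

  addP-cong : ∀ {p p′ r r′} → p ≋ p′ → r ≋ r′ → addP p r ≋ addP p′ r′
  addP-cong {p} {p′} {r} {r′} e f = mk λ i → begin
    coeff (addP p r) i         ≡⟨ coeff-add p r i ⟩
    coeff p i +ℤ coeff r i     ≡⟨ cong₂ _+ℤ_ (at e i) (at f i) ⟩
    coeff p′ i +ℤ coeff r′ i   ≡⟨ coeff-add p′ r′ i ⟨
    coeff (addP p′ r′) i       ∎

  scaleP-cong : ∀ {c p p′} → p ≋ p′ → scaleP c p ≋ scaleP c p′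
  scaleP-cong {c} {p} {p′} e = mk λ i →
    trans (coeff-scale c p i) (trans (cong (c *ℤ_) (at e i)) (sym (coeff-scale c p′ i)))

  addP-comm : ∀ p r → addP p r ≋ addP r p
  addP-comm p r = mk λ i → begin
    coeff (addP p r) i       ≡⟨ coeff-add p r i ⟩
    coeff p i +ℤ coeff r i   ≡⟨ ℤ.+-comm (coeff p i) (coeff r i) ⟩
    coeff r i +ℤ coeff p i   ≡⟨ coeff-add r p i ⟨
    coeff (addP r p) i       ∎

  addP-assoc : ∀ p r t → addP (addP p r) t ≋ addP p (addP r t)
  addP-assoc p r t = mk λ i → begin
    coeff (addP (addP p r) t) i                ≡⟨ coeff-add (addP p r) t i ⟩
    coeff (addP p r) i +ℤ coeff t i            ≡⟨ cong (_+ℤ coeff t i) (coeff-add p r i) ⟩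
    (coeff p i +ℤ coeff r i) +ℤ coeff t i      ≡⟨ ℤ.+-assoc (coeff p i) (coeff r i) (coeff t i) ⟩
    coeff p i +ℤ (coeff r i +ℤ coeff t i)      ≡⟨ cong (coeff p i +ℤ_) (coeff-add r t i) ⟨
    coeff p i +ℤ coeff (addP r t) i            ≡⟨ coeff-add p (addP r t) i ⟨
    coeff (addP p (addP r t)) i                ∎

  negP : Poly → Poly
  negP = scaleP -[1+ 0 ]

  addP-negP : ∀ p → addP p (negP p) ≋ []
  addP-negP p = mk λ i → begin
    coeff (addP p (negP p)) i               ≡⟨ coeff-add p (negP p) i ⟩
    coeff p i +ℤ coeff (negP p) i           ≡⟨ cong (coeff p i +ℤ_) (coeff-scale -[1+ 0 ] p i) ⟩
    coeff p i +ℤ -[1+ 0 ] *ℤ coeff p i      ≡⟨ cong (coeff p i +ℤ_) (ℤ.-1*i≡-i (coeff p i)) ⟩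
    coeff p i +ℤ Data.Integer.- coeff p i   ≡⟨ ℤ.+-inverseʳ (coeff p i) ⟩
    + 0                                     ∎

  scaleP-zero : ∀ p → scaleP (+ 0) p ≋ []
  scaleP-zero []       = ≋-refl
  scaleP-zero (x ∷ xs) = ∷-zero (scaleP-zero xs)

  mulP-nilʳ : ∀ p → mulP p [] ≋ []
  mulP-nilʳ []       = ≋-refl
  mulP-nilʳ (x ∷ xs) = ∷-zero (mulP-nilʳ xs)

  mulP-q : ∀ p r → mulP (+ 0 ∷ p) r ≋ (+ 0 ∷ mulP p r)
  mulP-q p r = addP-cong {scaleP (+ 0) r} {[]} (scaleP-zero r) ≋-refl

  mulP-oneˡ : ∀ p → mulP (+ 1 ∷ []) p ≋ p
  mulP-oneˡ p = mk λ i → begin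
    coeff (mulP (+ 1 ∷ []) p) i                ≡⟨ coeff-mul (+ 1) [] p i ⟩
    + 1 *ℤ coeff p i +ℤ coeff↑ [] i            ≡⟨ cong₂ _+ℤ_ (ℤ.*-identityˡ (coeff p i)) (coeff-nil↑ i) ⟩
    coeff p i +ℤ + 0                           ≡⟨ ℤ.+-identityʳ (coeff p i) ⟩
    coeff p i                                  ∎

  mulP-congʳ : ∀ p {r r′} → r ≋ r′ → mulP p r ≋ mulP p r′
  mulP-congʳ []       e = ≋-refl
  mulP-congʳ (x ∷ xs) {r} {r′} e = mk λ i → begin
    coeff (mulP (x ∷ xs) r) i                   ≡⟨ coeff-mul x xs r i ⟩
    x *ℤ coeff r i +ℤ coeff↑ (mulP xs r) i      ≡⟨ cong₂ _+ℤ_ (cong (x *ℤ_) (at e i)) (coeff↑-cong (mulP-congʳ xs e) i) ⟩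
    x *ℤ coeff r′ i +ℤ coeff↑ (mulP xs r′) i    ≡⟨ coeff-mul x xs r′ i ⟨
    coeff (mulP (x ∷ xs) r′) i                  ∎

  mulP-zeroˡ : ∀ {p} r → p ≋ [] → mulP p r ≋ []
  mulP-zeroˡ {[]}     r e = ≋-refl
  mulP-zeroˡ {x ∷ xs} r e = mk λ i → begin
    coeff (mulP (x ∷ xs) r) i                   ≡⟨ coeff-mul x xs r i ⟩
    x *ℤ coeff r i +ℤ coeff↑ (mulP xs r) i      ≡⟨ cong₂ _+ℤ_ (cong (_*ℤ coeff r i) (∷-head-zero e)) (coeff↑-cong (mulP-zeroˡ r (∷-tail-zero e)) i) ⟩
    + 0 *ℤ coeff r i +ℤ coeff↑ [] i             ≡⟨ cong (+ 0 *ℤ coeff r i +ℤ_) (coeff-nil↑ i) ⟩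
    + 0                                         ∎

  mulP-congˡ : ∀ {p p′} r → p ≋ p′ → mulP p r ≋ mulP p′ r
  mulP-congˡ {[]}     {p′}      r e = ≋-sym (mulP-zeroˡ r (≋-sym e))
  mulP-congˡ {x ∷ xs} {[]}      r e = mulP-zeroˡ r e
  mulP-congˡ {x ∷ xs} {x′ ∷ xs′} r e = mk λ i → begin
    coeff (mulP (x ∷ xs) r) i                   ≡⟨ coeff-mul x xs r i ⟩
    x *ℤ coeff r i +ℤ coeff↑ (mulP xs r) i      ≡⟨ cong₂ _+ℤ_ (cong (_*ℤ coeff r i) (∷-head e)) (coeff↑-cong (mulP-congˡ r (∷-tail e)) i) ⟩
    x′ *ℤ coeff r i +ℤ coeff↑ (mulP xs′ r) i    ≡⟨ coeff-mul x′ xs′ r i ⟨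
    coeff (mulP (x′ ∷ xs′) r) i                 ∎

  mulP-cong : ∀ {p p′ r r′} → p ≋ p′ → r ≋ r′ → mulP p r ≋ mulP p′ r′
  mulP-cong {p′ = p′} {r = r} e f = ≋-trans (mulP-congˡ r e) (mulP-congʳ p′ f)

  mulP-∷ʳ : ∀ p y ys → mulP p (y ∷ ys) ≋ addP (scaleP y p) (+ 0 ∷ mulP p ys)
  mulP-∷ʳ []       y ys = mk λ { zero → refl ; (suc i) → refl }
  mulP-∷ʳ (x ∷ xs) y ys = mk λ i → begin
    coeff (mulP (x ∷ xs) (y ∷ ys)) i
      ≡⟨ coeff-mul x xs (y ∷ ys) i ⟩
    x *ℤ coeff (y ∷ ys) i +ℤ coeff↑ (mulP xs (y ∷ ys)) i
      ≡⟨ cong (x *ℤ coeff (y ∷ ys) i +ℤ_) (coeff↑-cong (mulP-∷ʳ xs y ys) i) ⟩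
    x *ℤ coeff (y ∷ ys) i +ℤ coeff↑ (addP (scaleP y xs) (+ 0 ∷ mulP xs ys)) i
      ≡⟨ swap i ⟩
    y *ℤ coeff (x ∷ xs) i +ℤ coeff↑ (mulP (x ∷ xs) ys) i
      ≡⟨ cong₂ _+ℤ_ (coeff-scale y (x ∷ xs) i) (coeff-↑ _ i) ⟨
    coeff (scaleP y (x ∷ xs)) i +ℤ coeff (+ 0 ∷ mulP (x ∷ xs) ys) i
      ≡⟨ coeff-add (scaleP y (x ∷ xs)) (+ 0 ∷ mulP (x ∷ xs) ys) i ⟨
    coeff (addP (scaleP y (x ∷ xs)) (+ 0 ∷ mulP (x ∷ xs) ys)) i
      ∎
    where
    exchange : ∀ a b c → a +ℤ (b +ℤ c) ≡ b +ℤ (a +ℤ c)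
    exchange = solve-∀
    swap : ∀ i → x *ℤ coeff (y ∷ ys) i +ℤ coeff↑ (addP (scaleP y xs) (+ 0 ∷ mulP xs ys)) i
               ≡ y *ℤ coeff (x ∷ xs) i +ℤ coeff↑ (mulP (x ∷ xs) ys) i
    swap zero    = trans (ℤ.+-identityʳ _) (trans (ℤ.*-comm x y) (sym (ℤ.+-identityʳ _)))
    swap (suc i) = begin
      x *ℤ coeff ys i +ℤ coeff (addP (scaleP y xs) (+ 0 ∷ mulP xs ys)) i
        ≡⟨ cong (x *ℤ coeff ys i +ℤ_) (trans (coeff-add (scaleP y xs) _ i) (cong₂ _+ℤ_ (coeff-scale y xs i) (coeff-↑ _ i))) ⟩
      x *ℤ coeff ys i +ℤ (y *ℤ coeff xs i +ℤ coeff↑ (mulP xs ys) i)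
        ≡⟨ exchange (x *ℤ coeff ys i) (y *ℤ coeff xs i) _ ⟩
      y *ℤ coeff xs i +ℤ (x *ℤ coeff ys i +ℤ coeff↑ (mulP xs ys) i)
        ≡⟨ cong (y *ℤ coeff xs i +ℤ_) (coeff-mul x xs ys i) ⟨
      y *ℤ coeff xs i +ℤ coeff (mulP (x ∷ xs) ys) i
        ∎

  mulP-comm : ∀ p r → mulP p r ≋ mulP r p
  mulP-comm []       r = ≋-sym (mulP-nilʳ r)
  mulP-comm (x ∷ xs) r = ≋-trans (addP-cong {scaleP x r} ≋-refl (∷-cong refl (mulP-comm xs r))) (≋-sym (mulP-∷ʳ r x xs))

  mulP-distribˡ : ∀ p r t → mulP p (addP r t) ≋ addP (mulP p r) (mulP p t)
  mulP-distribˡ []       r t = ≋-refl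
  mulP-distribˡ (x ∷ xs) r t = mk λ i → begin
    coeff (mulP (x ∷ xs) (addP r t)) i
      ≡⟨ coeff-mul x xs (addP r t) i ⟩
    x *ℤ coeff (addP r t) i +ℤ coeff↑ (mulP xs (addP r t)) i
      ≡⟨ cong₂ _+ℤ_ (cong (x *ℤ_) (coeff-add r t i)) (trans (coeff↑-cong (mulP-distribˡ xs r t) i) (coeff↑-add (mulP xs r) (mulP xs t) i)) ⟩
    x *ℤ (coeff r i +ℤ coeff t i) +ℤ (coeff↑ (mulP xs r) i +ℤ coeff↑ (mulP xs t) i)
      ≡⟨ regroup x _ _ _ _ ⟩
    (x *ℤ coeff r i +ℤ coeff↑ (mulP xs r) i) +ℤ (x *ℤ coeff t i +ℤ coeff↑ (mulP xs t) i)
      ≡⟨ cong₂ _+ℤ_ (coeff-mul x xs r i) (coeff-mul x xs t i) ⟨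
    coeff (mulP (x ∷ xs) r) i +ℤ coeff (mulP (x ∷ xs) t) i
      ≡⟨ coeff-add (mulP (x ∷ xs) r) (mulP (x ∷ xs) t) i ⟨
    coeff (addP (mulP (x ∷ xs) r) (mulP (x ∷ xs) t)) i
      ∎
    where
    regroup : ∀ a b c d e → a *ℤ (b +ℤ c) +ℤ (d +ℤ e) ≡ (a *ℤ b +ℤ d) +ℤ (a *ℤ c +ℤ e)
    regroup = solve-∀

  mulP-distribʳ : ∀ p r t → mulP (addP p r) t ≋ addP (mulP p t) (mulP r t)
  mulP-distribʳ p r t = ≋-trans (mulP-comm (addP p r) t)
    (≋-trans (mulP-distribˡ t p r) (addP-cong (mulP-comm t p) (mulP-comm t r)))

  mulP-scaleˡ : ∀ c p r → mulP (scaleP c p) r ≋ scaleP c (mulP p r)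
  mulP-scaleˡ c []       r = ≋-refl
  mulP-scaleˡ c (x ∷ xs) r = mk λ i → begin
    coeff (mulP (scaleP c (x ∷ xs)) r) i
      ≡⟨ coeff-mul (c *ℤ x) (scaleP c xs) r i ⟩
    (c *ℤ x) *ℤ coeff r i +ℤ coeff↑ (mulP (scaleP c xs) r) i
      ≡⟨ cong ((c *ℤ x) *ℤ coeff r i +ℤ_) (trans (coeff↑-cong (mulP-scaleˡ c xs r) i) (coeff↑-scale c (mulP xs r) i)) ⟩
    (c *ℤ x) *ℤ coeff r i +ℤ c *ℤ coeff↑ (mulP xs r) i
      ≡⟨ factor c x _ _ ⟩
    c *ℤ (x *ℤ coeff r i +ℤ coeff↑ (mulP xs r) i)
      ≡⟨ cong (c *ℤ_) (coeff-mul x xs r i) ⟨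
    c *ℤ coeff (mulP (x ∷ xs) r) i
      ≡⟨ coeff-scale c (mulP (x ∷ xs) r) i ⟨
    coeff (scaleP c (mulP (x ∷ xs) r)) i
      ∎
    where
    factor : ∀ c x a b → (c *ℤ x) *ℤ a +ℤ c *ℤ b ≡ c *ℤ (x *ℤ a +ℤ b)
    factor = solve-∀

  mulP-assoc : ∀ p r t → mulP (mulP p r) t ≋ mulP p (mulP r t)
  mulP-assoc []       r t = ≋-refl
  mulP-assoc (x ∷ xs) r t =
    ≋-trans (mulP-distribʳ (scaleP x r) (+ 0 ∷ mulP xs r) t)
      (addP-cong (mulP-scaleˡ x r t) (≋-trans (mulP-q (mulP xs r) t) (∷-cong refl (mulP-assoc xs r t))))

  shiftP-cong : ∀ m {p r} → p ≋ r → shiftP m p ≋ shiftP m r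
  shiftP-cong zero    e = e
  shiftP-cong (suc m) e = ∷-cong refl (shiftP-cong m e)

  shiftP-injective : ∀ m {p r} → shiftP m p ≋ shiftP m r → p ≋ r
  shiftP-injective zero    e = e
  shiftP-injective (suc m) e = shiftP-injective m (∷-tail e)

  shiftP-nil : ∀ m → shiftP m [] ≋ []
  shiftP-nil zero    = ≋-refl
  shiftP-nil (suc m) = ∷-zero (shiftP-nil m)

  shiftP-addP : ∀ m p r → shiftP m (addP p r) ≋ addP (shiftP m p) (shiftP m r)
  shiftP-addP zero    p r = ≋-refl
  shiftP-addP (suc m) p r = ∷-cong refl (shiftP-addP m p r)

  shiftP-scaleP : ∀ m c p → shiftP m (scaleP c p) ≋ scaleP c (shiftP m p)
  shiftP-scaleP zero    c p = ≋-refl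
  shiftP-scaleP (suc m) c p = ∷-cong (sym (ℤ.*-zeroʳ c)) (shiftP-scaleP m c p)

  shiftP-+ : ∀ a b p → shiftP a (shiftP b p) ≋ shiftP (a +ℕ b) p
  shiftP-+ zero    b p = ≋-refl
  shiftP-+ (suc a) b p = ∷-cong refl (shiftP-+ a b p)

  shiftP-shiftP : ∀ a b c d p → a +ℕ b ≡ c +ℕ d → shiftP a (shiftP b p) ≋ shiftP c (shiftP d p)
  shiftP-shiftP a b c d p e =
    ≋-trans (shiftP-+ a b p) (≋-trans (≋-reflexive (cong (λ k → shiftP k p) e)) (≋-sym (shiftP-+ c d p)))

  shiftP-mulPˡ : ∀ m p r → mulP (shiftP m p) r ≋ shiftP m (mulP p r)
  shiftP-mulPˡ zero    p r = ≋-refl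
  shiftP-mulPˡ (suc m) p r = ≋-trans (mulP-q (shiftP m p) r) (∷-cong refl (shiftP-mulPˡ m p r))

  shiftP-mulPʳ : ∀ m p r → mulP p (shiftP m r) ≋ shiftP m (mulP p r)
  shiftP-mulPʳ m p r = ≋-trans (mulP-comm p (shiftP m r))
    (≋-trans (shiftP-mulPˡ m r p) (shiftP-cong m (mulP-comm r p)))

  shiftP-mulP : ∀ a b p r → mulP (shiftP a p) (shiftP b r) ≋ shiftP (a +ℕ b) (mulP p r)
  shiftP-mulP a b p r = ≋-trans (shiftP-mulPˡ a p (shiftP b r))
    (≋-trans (shiftP-cong a (shiftP-mulPʳ b p r)) (shiftP-+ a b (mulP p r)))

  1-q-cancel : ∀ p → mulP (+ 1 ∷ -[1+ 0 ] ∷ []) p ≋ [] → p ≋ []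
  1-q-cancel p h = mk vanish
    where
    coeff-1-q : ∀ i → coeff (mulP (+ 1 ∷ -[1+ 0 ] ∷ []) p) i ≡ coeff p i +ℤ coeff↑ (scaleP -[1+ 0 ] p) i
    coeff-1-q i = begin
      coeff (mulP (+ 1 ∷ -[1+ 0 ] ∷ []) p) i                           ≡⟨ coeff-mul (+ 1) (-[1+ 0 ] ∷ []) p i ⟩
      + 1 *ℤ coeff p i +ℤ coeff↑ (mulP (-[1+ 0 ] ∷ []) p) i            ≡⟨ cong₂ _+ℤ_ (ℤ.*-identityˡ (coeff p i)) (coeff↑-cong (addP-cong {scaleP -[1+ 0 ] p} ≋-refl (∷-zero ≋-refl)) i) ⟩
      coeff p i +ℤ coeff↑ (addP (scaleP -[1+ 0 ] p) []) i              ≡⟨ cong (coeff p i +ℤ_) (coeff↑-cong (mk λ j → trans (coeff-add (scaleP -[1+ 0 ] p) [] j) (ℤ.+-identityʳ _)) i) ⟩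
      coeff p i +ℤ coeff↑ (scaleP -[1+ 0 ] p) i                        ∎
    vanish : ∀ i → coeff p i ≡ coeff [] i
    vanish zero    = trans (sym (ℤ.+-identityʳ (coeff p 0))) (trans (sym (coeff-1-q 0)) (at h 0))
    vanish (suc i) = begin
      coeff p (suc i)                                       ≡⟨ ℤ.+-identityʳ (coeff p (suc i)) ⟨
      coeff p (suc i) +ℤ + 0                                ≡⟨ cong (coeff p (suc i) +ℤ_) (trans (sym (ℤ.*-zeroʳ -[1+ 0 ])) (cong (-[1+ 0 ] *ℤ_) (sym (vanish i)))) ⟩
      coeff p (suc i) +ℤ -[1+ 0 ] *ℤ coeff p i              ≡⟨ cong (coeff p (suc i) +ℤ_) (coeff-scale -[1+ 0 ] p i) ⟨
      coeff p (suc i) +ℤ coeff↑ (scaleP -[1+ 0 ] p) (suc i) ≡⟨ coeff-1-q (suc i) ⟨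
      coeff (mulP (+ 1 ∷ -[1+ 0 ] ∷ []) p) (suc i)          ≡⟨ at h (suc i) ⟩
      + 0                                                   ∎

module LaurentRing where

  open Polynomial
  open import Data.Nat using (ℕ; zero; suc) renaming (_+_ to _+ℕ_)
  import Data.Nat.Properties as ℕ
  open import Data.Nat.Tactic.RingSolver using () renaming (solve to solveℕ)
  open import Data.Integer using (ℤ; +_; -[1+_]) renaming (_+_ to _+ℤ_; _*_ to _*ℤ_)
  import Data.Integer as ℤ
  import Data.Integer.Properties as ℤ
  open import Data.List using ([]; _∷_)
  open import Data.Maybe using (Maybe; just; nothing)
  open import Data.Product using (_,_)
  open import Relation.Nullary using (yes; no)
  open import Relation.Binary.PropositionalEquality
  open import Relation.Binary.Structures using (IsEquivalence)
  open import Algebra.Bundles using (CommutativeRing; RawRing)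
  import Algebra.Solver.Ring.AlmostCommutativeRing as ACR

  -- _≈L_ wrapped in a record, for the same inference reasons as _≋_
  infix 4 _≃_
  record _≃_ (L L′ : Laurent) : Set where
    constructor mkL
    field atL : shiftP (den L′) (num L) ≋ shiftP (den L) (num L′)
  open _≃_ public

  ≃-refl : ∀ {L} → L ≃ L
  ≃-refl = mkL ≋-refl

  ≃-sym : ∀ {L L′} → L ≃ L′ → L′ ≃ L
  ≃-sym (mkL e) = mkL (≋-sym e)

  -- p/q^e = p′/q^e′ = p″/q^e″: compare all three after multiplying by q^{e′}
  ≃-trans : ∀ {A B C} → A ≃ B → B ≃ C → A ≃ C
  ≃-trans {p /q^ e} {p′ /q^ e′} {p″ /q^ e″} (mkL h₁) (mkL h₂) = mkL (shiftP-injective e′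
    (≋-trans (shiftP-shiftP e′ e″ e″ e′ p (ℕ.+-comm e′ e″))
    (≋-trans (shiftP-cong e″ h₁)
    (≋-trans (shiftP-shiftP e″ e e e″ p′ (ℕ.+-comm e″ e))
    (≋-trans (shiftP-cong e h₂)
    (shiftP-shiftP e e′ e′ e p″ (ℕ.+-comm e e′)))))))

  ≃-reflexive : ∀ {L L′} → L ≡ L′ → L ≃ L′
  ≃-reflexive refl = ≃-refl

  fraction-cong : ∀ {p p′ e e′} → e ≡ e′ → p ≋ p′ → (p /q^ e) ≃ (p′ /q^ e′)
  fraction-cong {e = e} refl h = mkL (shiftP-cong e h)

  fraction-expand : ∀ k p e → (p /q^ e) ≃ (shiftP k p /q^ (e +ℕ k))
  fraction-expand k p e = mkL (≋-sym (shiftP-+ e k p))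

  +L-cong : ∀ {A A′ B B′} → A ≃ A′ → B ≃ B′ → (A +L B) ≃ (A′ +L B′)
  +L-cong {p /q^ e} {p′ /q^ e′} {r /q^ f} {r′ /q^ f′} (mkL h₁) (mkL h₂) = mkL
    (≋-trans (shiftP-addP (e′ +ℕ f′) (shiftP f p) (shiftP e r))
    (≋-trans (addP-cong left right)
    (≋-sym (shiftP-addP (e +ℕ f) (shiftP f′ p′) (shiftP e′ r′)))))
    where
    left : shiftP (e′ +ℕ f′) (shiftP f p) ≋ shiftP (e +ℕ f) (shiftP f′ p′)
    left = ≋-trans (shiftP-shiftP (e′ +ℕ f′) f (f′ +ℕ f) e′ p (solveℕ (e′ ∷ f′ ∷ f ∷ [])))
           (≋-trans (shiftP-cong (f′ +ℕ f) h₁) (shiftP-shiftP (f′ +ℕ f) e (e +ℕ f) f′ p′ (solveℕ (f′ ∷ f ∷ e ∷ []))))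
    right : shiftP (e′ +ℕ f′) (shiftP e r) ≋ shiftP (e +ℕ f) (shiftP e′ r′)
    right = ≋-trans (shiftP-shiftP (e′ +ℕ f′) e (e′ +ℕ e) f′ r (solveℕ (e′ ∷ f′ ∷ e ∷ [])))
            (≋-trans (shiftP-cong (e′ +ℕ e) h₂) (shiftP-shiftP (e′ +ℕ e) f (e +ℕ f) e′ r′ (solveℕ (e′ ∷ e ∷ f ∷ []))))

  +L-comm : ∀ A B → (A +L B) ≃ (B +L A)
  +L-comm (p /q^ e) (r /q^ f) = fraction-cong (ℕ.+-comm e f) (addP-comm (shiftP f p) (shiftP e r))

  +L-assoc : ∀ A B C → ((A +L B) +L C) ≃ (A +L (B +L C))
  +L-assoc (p /q^ e) (r /q^ f) (t /q^ g) = fraction-cong (ℕ.+-assoc e f g)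
    (≋-trans (addP-cong
       (≋-trans (shiftP-addP g (shiftP f p) (shiftP e r))
                (addP-cong (shiftP-+ g f p) (shiftP-shiftP g e e g r (ℕ.+-comm g e))))
       (≋-sym (shiftP-+ e f t)))
    (≋-trans (addP-assoc (shiftP (g +ℕ f) p) (shiftP e (shiftP g r)) (shiftP e (shiftP f t)))
    (addP-cong (≋-reflexive (cong (λ k → shiftP k p) (ℕ.+-comm g f))) (≋-sym (shiftP-addP e (shiftP g r) (shiftP f t))))))

  +L-identityˡ : ∀ A → (zeroL +L A) ≃ A
  +L-identityˡ (p /q^ e) = fraction-cong refl (addP-cong {shiftP e []} {[]} (shiftP-nil e) ≋-refl)

  +L-identityʳ : ∀ A → (A +L zeroL) ≃ A
  +L-identityʳ A = ≃-trans (+L-comm A zeroL) (+L-identityˡ A)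

  negL-cong : ∀ {A A′} → A ≃ A′ → negL A ≃ negL A′
  negL-cong {p /q^ e} {p′ /q^ e′} (mkL h) = mkL
    (≋-trans (shiftP-scaleP e′ -[1+ 0 ] p)
    (≋-trans (scaleP-cong { -[1+ 0 ]} h) (≋-sym (shiftP-scaleP e -[1+ 0 ] p′))))

  +L-inverseʳ : ∀ A → (A +L negL A) ≃ zeroL
  +L-inverseʳ (p /q^ e) = mkL
    (≋-trans (≋-sym (shiftP-addP e p (negP p)))
    (≋-trans (shiftP-cong e (addP-negP p))
    (≋-trans (shiftP-nil e) (≋-sym (shiftP-nil (e +ℕ e))))))

  +L-inverseˡ : ∀ A → (negL A +L A) ≃ zeroL
  +L-inverseˡ A = ≃-trans (+L-comm (negL A) A) (+L-inverseʳ A)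

  *L-cong : ∀ {A A′ B B′} → A ≃ A′ → B ≃ B′ → (A *L B) ≃ (A′ *L B′)
  *L-cong {p /q^ e} {p′ /q^ e′} {r /q^ f} {r′ /q^ f′} (mkL h₁) (mkL h₂) = mkL
    (≋-trans (≋-sym (shiftP-mulP e′ f′ p r))
    (≋-trans (mulP-cong h₁ h₂) (shiftP-mulP e f p′ r′)))

  *L-comm : ∀ A B → (A *L B) ≃ (B *L A)
  *L-comm (p /q^ e) (r /q^ f) = fraction-cong (ℕ.+-comm e f) (mulP-comm p r)

  *L-assoc : ∀ A B C → ((A *L B) *L C) ≃ (A *L (B *L C))
  *L-assoc (p /q^ e) (r /q^ f) (t /q^ g) = fraction-cong (ℕ.+-assoc e f g) (mulP-assoc p r t)

  *L-identityˡ : ∀ A → (oneL *L A) ≃ A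
  *L-identityˡ (p /q^ e) = fraction-cong refl (mulP-oneˡ p)

  *L-identityʳ : ∀ A → (A *L oneL) ≃ A
  *L-identityʳ A = ≃-trans (*L-comm A oneL) (*L-identityˡ A)

  -- after expanding p/q^e by q^e, both sides have denominator q^{2e+f+g}
  *L-distribˡ : ∀ A B C → (A *L (B +L C)) ≃ ((A *L B) +L (A *L C))
  *L-distribˡ (p /q^ e) (r /q^ f) (t /q^ g) =
    ≃-trans (fraction-expand e (mulP p (addP (shiftP g r) (shiftP f t))) (e +ℕ (f +ℕ g)))
    (fraction-cong denominators
    (≋-trans (shiftP-cong e (mulP-distribˡ p (shiftP g r) (shiftP f t)))
    (≋-trans (shiftP-addP e (mulP p (shiftP g r)) (mulP p (shiftP f t)))
    (addP-cong (≋-trans (shiftP-cong e (shiftP-mulPʳ g p r)) (shiftP-shiftP e g (e +ℕ g) 0 (mulP p r) (solveℕ (e ∷ g ∷ []))))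
               (≋-trans (shiftP-cong e (shiftP-mulPʳ f p t)) (shiftP-shiftP e f (e +ℕ f) 0 (mulP p t) (solveℕ (e ∷ f ∷ []))))))))
    where
    denominators : e +ℕ (f +ℕ g) +ℕ e ≡ (e +ℕ f) +ℕ (e +ℕ g)
    denominators = solveℕ (e ∷ f ∷ g ∷ [])

  *L-distribʳ : ∀ A B C → ((B +L C) *L A) ≃ ((B *L A) +L (C *L A))
  *L-distribʳ A B C = ≃-trans (*L-comm (B +L C) A)
    (≃-trans (*L-distribˡ A B C) (+L-cong (*L-comm A B) (*L-comm A C)))

  ≃-isEquivalence : IsEquivalence _≃_
  ≃-isEquivalence = record { refl = ≃-refl ; sym = ≃-sym ; trans = ≃-trans }

  open import Algebra.Structures {A = Laurent} _≃_ using (IsCommutativeRing)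

  isCommutativeRing : IsCommutativeRing _+L_ _*L_ negL zeroL oneL
  isCommutativeRing = record
    { isRing = record
      { +-isAbelianGroup = record
        { isGroup = record
          { isMonoid = record
            { isSemigroup = record
              { isMagma = record { isEquivalence = ≃-isEquivalence ; ∙-cong = +L-cong }
              ; assoc = +L-assoc }
            ; identity = +L-identityˡ , +L-identityʳ }
          ; inverse = +L-inverseˡ , +L-inverseʳ
          ; ⁻¹-cong = negL-cong }
        ; comm = +L-comm }
      ; *-cong = *L-cong
      ; *-assoc = *L-assoc
      ; *-identity = *L-identityˡ , *L-identityʳ
      ; distrib = *L-distribˡ , *L-distribʳ }
    ; *-comm = *L-comm }

  laurentRing : CommutativeRing _ _
  laurentRing = record { isCommutativeRing = isCommutativeRing }

  almostCommutativeRing : ACR.AlmostCommutativeRing _ _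
  almostCommutativeRing = ACR.fromCommutativeRing laurentRing

  const : ℤ → Laurent
  const c = (c ∷ []) /q^ 0

  const-zero : const (+ 0) ≃ zeroL
  const-zero = mkL (mk λ { zero → refl ; (suc i) → refl })

  integers : RawRing _ _
  integers = record { Carrier = ℤ ; _≈_ = _≡_ ; _+_ = _+ℤ_ ; _*_ = _*ℤ_ ; -_ = ℤ.-_ ; 0# = + 0 ; 1# = + 1 }

  const-homomorphism : integers ACR.-Raw-AlmostCommutative⟶ almostCommutativeRing
  const-homomorphism = record
    { ⟦_⟧    = const
    ; +-homo = λ a b → ≃-refl
    ; *-homo = λ a b → mkL (∷-cong (sym (ℤ.+-identityʳ _)) ≋-refl)
    ; -‿homo = λ a → mkL (∷-cong (sym (ℤ.-1*i≡-i a)) ≋-refl)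
    ; 0-homo = const-zero
    ; 1-homo = ≃-refl
    }

  const-equal? : ∀ x y → Maybe (const x ≃ const y)
  const-equal? x y with x ℤ.≟ y
  ... | yes refl = just ≃-refl
  ... | no _     = nothing

  open import Algebra.Solver.Ring integers almostCommutativeRing const-homomorphism const-equal? public
    using (solve; _:=_; con; _:+_; _:*_; _:-_; :-_)
  open CommutativeRing laurentRing public using (_+_; _*_; -_; _-_; 0#; 1#; +-cong; *-cong; -‿cong; +-comm; +-assoc; +-identityʳ; *-comm; *-assoc; *-identityˡ; *-identityʳ; distribˡ; zeroˡ; zeroʳ; setoid; commutativeSemiring)

module QAnalogues where

  open Polynomial
  open LaurentRing
  open import Data.Nat using (ℕ; zero; suc; _<_; s≤s) renaming (_+_ to _+ℕ_; _*_ to _*ℕ_)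
  import Data.Nat.Properties as ℕ
  open import Data.Integer using (+_)
  import Data.Integer as ℤ
  open import Data.List using ([]; _∷_)
  open import Relation.Binary.PropositionalEquality using (_≡_; refl; cong; sym)
  open import Relation.Binary.Reasoning.Setoid setoid
  open import Algebra.Properties.CommutativeSemiring.Exp commutativeSemiring public
    using (_^_; ^-homo-*; ^-distrib-*)

  infixr 8 q^_ q^-_

  q^_ : ℕ → Laurent
  q^ m = qPow (+ m)

  q^-_ : ℕ → Laurent
  q^- m = (+ 1 ∷ []) /q^ m

  q : Laurent
  q = q^ 1

  [_] : ℕ → Laurent
  [ m ] = fromPoly (qInt m)

  binom : ℕ → ℕ → Laurent
  binom m j = fromPoly (qBin m j)

  [_]-cong : ∀ {m m′} → m ≡ m′ → [ m ] ≃ [ m′ ]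
  [_]-cong refl = ≃-refl

  binom-cong : ∀ {m m′ j j′} → m ≡ m′ → j ≡ j′ → binom m j ≃ binom m′ j′
  binom-cong refl refl = ≃-refl

  q^-+ : ∀ a b → q^ (a +ℕ b) ≃ q^ a * q^ b
  q^-+ a b = fraction-cong refl (≋-sym (≋-trans (shiftP-mulP a b (+ 1 ∷ []) (+ 1 ∷ [])) (shiftP-cong (a +ℕ b) (mulP-oneˡ (+ 1 ∷ [])))))

  q^--+ : ∀ a b → q^- (a +ℕ b) ≃ q^- a * q^- b
  q^--+ a b = fraction-cong refl (≋-sym (mulP-oneˡ (+ 1 ∷ [])))

  q^-inverse : ∀ m → q^ m * q^- m ≃ 1#
  q^-inverse m = mkL (≋-trans (mulP-comm (shiftP m (+ 1 ∷ [])) (+ 1 ∷ [])) (mulP-oneˡ _))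

  q^-inverseˡ : ∀ m → q^- m * q^ m ≃ 1#
  q^-inverseˡ m = ≃-trans (*-comm (q^- m) (q^ m)) (q^-inverse m)

  qPow-negative : ∀ m → qPow (ℤ.- (+ m)) ≃ q^- m
  qPow-negative zero    = ≃-refl
  qPow-negative (suc m) = ≃-refl

  q^-* : ∀ e k → q^- (e *ℕ k) ≃ (q^- k) ^ e
  q^-* zero    k = ≃-refl
  q^-* (suc e) k = ≃-trans (q^--+ k (e *ℕ k)) (*-cong (≃-refl {q^- k}) (q^-* e k))

  fromPoly-shiftP : ∀ m p → fromPoly (shiftP m p) ≃ q^ m * fromPoly p
  fromPoly-shiftP m p = fraction-cong refl (≋-sym (≋-trans (shiftP-mulPˡ m (+ 1 ∷ []) p) (shiftP-cong m (mulP-oneˡ p))))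

  fromPoly-powP : ∀ p e → fromPoly (powP p e) ≃ fromPoly p ^ e
  fromPoly-powP p zero    = ≃-refl
  fromPoly-powP p (suc e) = *-cong (≃-refl {fromPoly p}) (fromPoly-powP p e)

  [suc] : ∀ m → [ suc m ] ≃ 1# + q * [ m ]
  [suc] m = fraction-cong refl (≋-sym (addP-cong {+ 1 ∷ []} ≋-refl (≋-trans (mulP-q (+ 1 ∷ []) (qInt m)) (∷-cong refl (mulP-oneˡ (qInt m))))))

  [+] : ∀ a b → [ a +ℕ b ] ≃ [ a ] + q^ a * [ b ]
  [+] zero    b = begin
    [ b ]                        ≈⟨ solve 1 (λ x → x := con (+ 0) :+ con (+ 1) :* x) ≃-refl [ b ] ⟩
    const (+ 0) + 1# * [ b ]     ≈⟨ +-cong const-zero (≃-refl {1# * [ b ]}) ⟩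
    0# + 1# * [ b ]              ∎
  [+] (suc a) b = begin
    [ suc (a +ℕ b) ]                       ≈⟨ [suc] (a +ℕ b) ⟩
    1# + q * [ a +ℕ b ]                    ≈⟨ +-cong (≃-refl {1#}) (*-cong (≃-refl {q}) ([+] a b)) ⟩
    1# + q * ([ a ] + q^ a * [ b ])        ≈⟨ solve 4 (λ q x y z → con (+ 1) :+ q :* (x :+ y :* z) := (con (+ 1) :+ q :* x) :+ (q :* y) :* z) ≃-refl q [ a ] (q^ a) [ b ] ⟩
    (1# + q * [ a ]) + (q * q^ a) * [ b ]  ≈⟨ +-cong ([suc] a) (*-cong (q^-+ 1 a) (≃-refl {[ b ]})) ⟨
    [ suc a ] + q^ suc a * [ b ]           ∎

  geometric : ∀ m → (1# - q) * [ m ] ≃ 1# - q^ m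
  geometric zero    = mkL (mk λ { zero → refl ; (suc zero) → refl ; (suc (suc i)) → refl })
  geometric (suc m) = begin
    (1# - q) * [ suc m ]                    ≈⟨ *-cong (≃-refl {1# - q}) ([suc] m) ⟩
    (1# - q) * (1# + q * [ m ])             ≈⟨ solve 2 (λ q x → (con (+ 1) :- q) :* (con (+ 1) :+ q :* x) := (con (+ 1) :- q) :+ q :* ((con (+ 1) :- q) :* x)) ≃-refl q [ m ] ⟩
    (1# - q) + q * ((1# - q) * [ m ])       ≈⟨ +-cong (≃-refl {1# - q}) (*-cong (≃-refl {q}) (geometric m)) ⟩
    (1# - q) + q * (1# - q^ m)              ≈⟨ solve 2 (λ q y → (con (+ 1) :- q) :+ q :* (con (+ 1) :- y) := con (+ 1) :- q :* y) ≃-refl q (q^ m) ⟩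
    1# - q * q^ m                           ≈⟨ +-cong (≃-refl {1#}) (-‿cong (q^-+ 1 m)) ⟨
    1# - q^ suc m                           ∎

  1-q-cancel-zero : ∀ A → (1# - q) * A ≃ 0# → A ≃ 0#
  1-q-cancel-zero (p /q^ e) (mkL h) = mkL (≋-trans (1-q-cancel p (≋-trans h (shiftP-nil e))) (≋-sym (shiftP-nil e)))

  1-q-cancel-≃ : ∀ A C → (1# - q) * A ≃ (1# - q) * C → A ≃ C
  1-q-cancel-≃ A C h = begin
    A                   ≈⟨ solve 2 (λ a c → a := (a :- c) :+ c) ≃-refl A C ⟩
    (A - C) + C         ≈⟨ +-cong (1-q-cancel-zero (A - C) difference) (≃-refl {C}) ⟩
    0# + C              ≈⟨ +-cong (≃-sym const-zero) (≃-refl {C}) ⟩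
    const (+ 0) + C     ≈⟨ solve 1 (λ c → con (+ 0) :+ c := c) ≃-refl C ⟩
    C                   ∎
    where
    difference : (1# - q) * (A - C) ≃ 0#
    difference = begin
      (1# - q) * (A - C)                   ≈⟨ solve 3 (λ t a c → t :* (a :- c) := t :* a :- t :* c) ≃-refl (1# - q) A C ⟩
      (1# - q) * A - (1# - q) * C          ≈⟨ +-cong h (≃-refl { - ((1# - q) * C)}) ⟩
      (1# - q) * C - (1# - q) * C          ≈⟨ solve 1 (λ x → x :- x := con (+ 0)) ≃-refl ((1# - q) * C) ⟩
      const (+ 0)                          ≈⟨ const-zero ⟩
      0#                                   ∎

  binom-zero : ∀ m → binom m 0 ≃ 1#
  binom-zero zero    = ≃-refl
  binom-zero (suc m) = ≃-refl

  binom-vanish : ∀ m j → m < j → binom m j ≃ 0#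
  binom-vanish m j m<j = fraction-cong refl (vanish m j m<j)
    where
    vanish : ∀ m j → m < j → qBin m j ≋ []
    vanish zero    (suc j) _         = ≋-refl
    vanish (suc m) (suc j) (s≤s m<j) = addP-cong (vanish m j m<j)
      (≋-trans (shiftP-cong (suc j) (vanish m (suc j) (ℕ.m<n⇒m<1+n m<j))) (shiftP-nil (suc j)))

  pascal : ∀ m j → binom (suc m) (suc j) ≃ binom m j + q^ suc j * binom m (suc j)
  pascal m j = +-cong (≃-refl {binom m j}) (fromPoly-shiftP (suc j) (qBin m (suc j)))

  binom-one : ∀ m → binom m 1 ≃ [ m ]
  binom-one zero    = ≃-refl
  binom-one (suc m) = begin
    binom (suc m) 1              ≈⟨ pascal m 0 ⟩
    binom m 0 + q * binom m 1    ≈⟨ +-cong (binom-zero m) (*-cong (≃-refl {q}) (binom-one m)) ⟩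
    1# + q * [ m ]               ≈⟨ [suc] m ⟨
    [ suc m ]                    ∎

  -- Absorption, in the form free of subtraction (m = j + d):
  -- [m - j] [m brack j] = [j+1] [m brack j+1].
  absorb-step : ∀ j d → [ d ] * binom (j +ℕ d) j ≃ [ suc j ] * binom (j +ℕ d) (suc j)
  absorb-step zero d = begin
    [ d ] * binom d 0          ≈⟨ *-cong (≃-refl {[ d ]}) (binom-zero d) ⟩
    [ d ] * 1#                 ≈⟨ *-comm [ d ] 1# ⟩
    1# * [ d ]                 ≈⟨ *-cong (≃-refl {1#}) (binom-one d) ⟨
    [ 1 ] * binom d 1          ∎
  absorb-step (suc j) zero = begin
    [ 0 ] * binom (suc j +ℕ 0) (suc j)          ≈⟨ zeroˡ (binom (suc j +ℕ 0) (suc j)) ⟩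
    0#                                          ≈⟨ zeroʳ [ suc (suc j) ] ⟨
    [ suc (suc j) ] * 0#                        ≈⟨ *-cong (≃-refl {[ suc (suc j) ]}) (binom-vanish (suc j +ℕ 0) (suc (suc j)) (s≤s (s≤s (ℕ.≤-reflexive (ℕ.+-identityʳ j))))) ⟨
    [ suc (suc j) ] * binom (suc j +ℕ 0) (suc (suc j)) ∎
  absorb-step (suc j) (suc d) = begin
    [ suc d ] * binom (suc M) (suc j)
      ≈⟨ *-cong (≃-refl {[ suc d ]}) (pascal M j) ⟩
    [ suc d ] * (binom M j + q^ suc j * X)
      ≈⟨ distribute [ suc d ] (binom M j) (q^ suc j) X ⟩
    [ suc d ] * binom M j + q^ suc j * ([ suc d ] * X)
      ≈⟨ +-cong (absorb-step j (suc d)) (≃-refl {q^ suc j * ([ suc d ] * X)}) ⟩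
    [ suc j ] * X + q^ suc j * ([ suc d ] * X)
      ≈⟨ collect [ suc j ] X (q^ suc j) [ suc d ] ⟩
    ([ suc j ] + q^ suc j * [ suc d ]) * X
      ≈⟨ *-cong (≃-trans (≃-sym ([+] (suc j) (suc d))) (≃-trans ([_]-cong (ℕ.+-suc (suc j) d)) ([+] (suc (suc j)) d))) (≃-refl {X}) ⟩
    ([ suc (suc j) ] + q^ suc (suc j) * [ d ]) * X
      ≈⟨ collect [ suc (suc j) ] X (q^ suc (suc j)) [ d ] ⟨
    [ suc (suc j) ] * X + q^ suc (suc j) * ([ d ] * X)
      ≈⟨ +-cong (≃-refl {[ suc (suc j) ] * X}) (*-cong (≃-refl {q^ suc (suc j)}) inner) ⟩
    [ suc (suc j) ] * X + q^ suc (suc j) * ([ suc (suc j) ] * W)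
      ≈⟨ distribute [ suc (suc j) ] X (q^ suc (suc j)) W ⟨
    [ suc (suc j) ] * (X + q^ suc (suc j) * W)
      ≈⟨ *-cong (≃-refl {[ suc (suc j) ]}) (pascal M (suc j)) ⟨
    [ suc (suc j) ] * binom (suc M) (suc (suc j))
      ∎
    where
    M = j +ℕ suc d
    X = binom M (suc j)
    W = binom M (suc (suc j))
    distribute : ∀ c y a x → c * (y + a * x) ≃ c * y + a * (c * x)
    distribute = solve 4 (λ c y a x → c :* (y :+ a :* x) := c :* y :+ a :* (c :* x)) ≃-refl
    collect : ∀ c x a e → c * x + a * (e * x) ≃ (c + a * e) * x
    collect = solve 4 (λ c x a e → c :* x :+ a :* (e :* x) := (c :+ a :* e) :* x) ≃-refl
    -- the induction hypothesis for (j+1, d), with j+1+d = j+(d+1) = M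
    inner : [ d ] * X ≃ [ suc (suc j) ] * W
    inner = ≃-trans (*-cong (≃-refl {[ d ]}) (binom-cong (ℕ.+-suc j d) refl))
            (≃-trans (absorb-step (suc j) d) (*-cong (≃-refl {[ suc (suc j) ]}) (binom-cong (sym (ℕ.+-suc j d)) refl)))

  absorb-top : ∀ j d → binom (suc (j +ℕ d)) (suc j) * [ suc j ] ≃ [ suc (j +ℕ d) ] * binom (j +ℕ d) j
  absorb-top j d = begin
    binom (suc m) (suc j) * [ suc j ]                  ≈⟨ *-cong (pascal m j) (≃-refl {[ suc j ]}) ⟩
    (binom m j + q^ suc j * binom m (suc j)) * [ suc j ] ≈⟨ expand (binom m j) (q^ suc j) (binom m (suc j)) [ suc j ] ⟩
    [ suc j ] * binom m j + q^ suc j * ([ suc j ] * binom m (suc j)) ≈⟨ +-cong (≃-refl {[ suc j ] * binom m j}) (*-cong (≃-refl {q^ suc j}) (absorb-step j d)) ⟨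
    [ suc j ] * binom m j + q^ suc j * ([ d ] * binom m j) ≈⟨ solve 4 (λ c x a e → c :* x :+ a :* (e :* x) := (c :+ a :* e) :* x) ≃-refl [ suc j ] (binom m j) (q^ suc j) [ d ] ⟩
    ([ suc j ] + q^ suc j * [ d ]) * binom m j         ≈⟨ *-cong ([+] (suc j) d) (≃-refl {binom m j}) ⟨
    [ suc m ] * binom m j                              ∎
    where
    m = j +ℕ d
    expand : ∀ y a x c → (y + a * x) * c ≃ c * y + a * (c * x)
    expand = solve 4 (λ y a x c → (y :+ a :* x) :* c := c :* y :+ a :* (c :* x)) ≃-refl

  absorb-bottom : ∀ j d → binom (suc (j +ℕ d)) j * [ suc d ] ≃ [ suc (j +ℕ d) ] * binom (j +ℕ d) j
  absorb-bottom zero d = begin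
    binom (suc d) 0 * [ suc d ]      ≈⟨ *-cong (binom-zero (suc d)) (≃-refl {[ suc d ]}) ⟩
    1# * [ suc d ]                   ≈⟨ *-comm 1# [ suc d ] ⟩
    [ suc d ] * 1#                   ≈⟨ *-cong (≃-refl {[ suc d ]}) (binom-zero d) ⟨
    [ suc d ] * binom d 0            ∎
  absorb-bottom (suc j) d = begin
    binom (suc m) (suc j) * [ suc d ]                       ≈⟨ *-cong (pascal m j) (≃-refl {[ suc d ]}) ⟩
    (binom m j + q^ suc j * binom m (suc j)) * [ suc d ]    ≈⟨ solve 4 (λ y a x c → (y :+ a :* x) :* c := c :* y :+ a :* (c :* x)) ≃-refl (binom m j) (q^ suc j) (binom m (suc j)) [ suc d ] ⟩
    [ suc d ] * binom m j + q^ suc j * ([ suc d ] * binom m (suc j)) ≈⟨ +-cong shifted (≃-refl {q^ suc j * ([ suc d ] * binom m (suc j))}) ⟩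
    [ suc j ] * binom m (suc j) + q^ suc j * ([ suc d ] * binom m (suc j)) ≈⟨ solve 4 (λ c x a e → c :* x :+ a :* (e :* x) := (c :+ a :* e) :* x) ≃-refl [ suc j ] (binom m (suc j)) (q^ suc j) [ suc d ] ⟩
    ([ suc j ] + q^ suc j * [ suc d ]) * binom m (suc j)    ≈⟨ *-cong (≃-trans (≃-sym ([+] (suc j) (suc d))) ([_]-cong (cong suc (ℕ.+-suc j d)))) (≃-refl {binom m (suc j)}) ⟩
    [ suc m ] * binom m (suc j)                             ∎
    where
    m = suc (j +ℕ d)
    -- absorb-step for (j, d+1), noting j + (d+1) = m
    shifted : [ suc d ] * binom m j ≃ [ suc j ] * binom m (suc j)
    shifted = ≃-trans (*-cong (≃-refl {[ suc d ]}) (binom-cong (sym (ℕ.+-suc j d)) refl))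
              (≃-trans (absorb-step j (suc d)) (*-cong (≃-refl {[ suc j ]}) (binom-cong (ℕ.+-suc j d) refl)))

  absorb-twice : ∀ d e → binom (suc (suc (d +ℕ e))) (suc d) * [ suc d ] * [ suc e ]
                         ≃ [ suc (suc (d +ℕ e)) ] * [ suc (d +ℕ e) ] * binom (d +ℕ e) d
  absorb-twice d e = begin
    binom (suc (suc N)) (suc d) * [ suc d ] * [ suc e ]     ≈⟨ *-cong top (≃-refl {[ suc e ]}) ⟩
    [ suc (suc N) ] * binom (suc N) d * [ suc e ]           ≈⟨ *-assoc [ suc (suc N) ] (binom (suc N) d) [ suc e ] ⟩
    [ suc (suc N) ] * (binom (suc N) d * [ suc e ])         ≈⟨ *-cong (≃-refl {[ suc (suc N) ]}) (absorb-bottom d e) ⟩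
    [ suc (suc N) ] * ([ suc N ] * binom N d)               ≈⟨ *-assoc [ suc (suc N) ] [ suc N ] (binom N d) ⟨
    [ suc (suc N) ] * [ suc N ] * binom N d                 ∎
    where
    N = d +ℕ e
    top : binom (suc (suc N)) (suc d) * [ suc d ] ≃ [ suc (suc N) ] * binom (suc N) d
    top = ≃-trans (*-cong (binom-cong {j = suc d} (cong suc (sym (ℕ.+-suc d e))) refl) (≃-refl {[ suc d ]}))
          (≃-trans (absorb-top d (suc e)) (*-cong ([_]-cong (cong suc (ℕ.+-suc d e))) (binom-cong {j = d} (ℕ.+-suc d e) refl)))

module SumsAndDivisibility where

  open LaurentRing
  open QAnalogues using (_^_)
  open import Data.Nat using (ℕ; zero; suc; _≤_; _<_; s≤s; _∸_) renaming (_+_ to _+ℕ_)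
  import Data.Nat.Properties as ℕ
  open import Data.Integer using (+_)
  open import Data.Empty using (⊥-elim)
  open import Relation.Binary.PropositionalEquality using (_≡_; refl; cong)
  open import Relation.Binary.Reasoning.Setoid setoid

  sumL-cong : ∀ m (f g : ℕ → Laurent) → (∀ i → i < m → f i ≃ g i) → sumL m f ≃ sumL m g
  sumL-cong zero    f g f≃g = ≃-refl
  sumL-cong (suc m) f g f≃g = +-cong (sumL-cong m f g (λ i i<m → f≃g i (ℕ.m<n⇒m<1+n i<m))) (f≃g m ℕ.≤-refl)

  sumL-+ : ∀ m (f g : ℕ → Laurent) → sumL m (λ i → f i + g i) ≃ sumL m f + sumL m g
  sumL-+ zero    f g = begin
    0#                 ≈⟨ const-zero ⟨
    const (+ 0)        ≈⟨ solve 0 (con (+ 0) := con (+ 0) :+ con (+ 0)) ≃-refl ⟩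
    const (+ 0) + const (+ 0) ≈⟨ +-cong const-zero const-zero ⟩
    0# + 0#            ∎
  sumL-+ (suc m) f g = ≃-trans (+-cong (sumL-+ m f g) (≃-refl {f m + g m}))
    (solve 4 (λ a b c d → (a :+ b) :+ (c :+ d) := (a :+ c) :+ (b :+ d)) ≃-refl (sumL m f) (sumL m g) (f m) (g m))

  sumL-scale : ∀ m c (f : ℕ → Laurent) → sumL m (λ i → c * f i) ≃ c * sumL m f
  sumL-scale zero    c f = ≃-sym (zeroʳ c)
  sumL-scale (suc m) c f = ≃-trans (+-cong (sumL-scale m c f) (≃-refl {c * f m}))
    (solve 3 (λ c x y → c :* x :+ c :* y := c :* (x :+ y)) ≃-refl c (sumL m f) (f m))

  sumL-first : ∀ m (f : ℕ → Laurent) → sumL (suc m) f ≃ f 0 + sumL m (λ i → f (suc i))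
  sumL-first zero    f = +-comm 0# (f 0)
  sumL-first (suc m) f = ≃-trans (+-cong (sumL-first m f) (≃-refl {f (suc m)}))
    (+-assoc (f 0) (sumL m (λ i → f (suc i))) (f (suc m)))

  sumL-length : ∀ {m m′} (f : ℕ → Laurent) → m ≡ m′ → sumL m f ≃ sumL m′ f
  sumL-length f refl = ≃-refl

  in-range : ∀ a n i → i < suc n ∸ a → a +ℕ i ≤ n
  in-range zero    n       i i<       = ℕ.≤-pred i<
  in-range (suc a) zero    i i<       = ⊥-elim (ℕ.n≮0 (ℕ.≤-trans i< (ℕ.≤-reflexive (ℕ.0∸n≡0 a))))
  in-range (suc a) (suc n) i i<       = s≤s (in-range a n i i<)

  sum-cong : ∀ a n (f g : ℕ → Laurent) → (∀ k → a ≤ k → k ≤ n → f k ≃ g k) → sumFromTo a n f ≃ sumFromTo a n g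
  sum-cong a n f g f≃g = sumL-cong (suc n ∸ a) (λ i → f (a +ℕ i)) (λ i → g (a +ℕ i))
    (λ i i< → f≃g (a +ℕ i) (ℕ.m≤m+n a i) (in-range a n i i<))

  sum-+ : ∀ a n (f g : ℕ → Laurent) → sumFromTo a n (λ k → f k + g k) ≃ sumFromTo a n f + sumFromTo a n g
  sum-+ a n f g = sumL-+ (suc n ∸ a) (λ i → f (a +ℕ i)) (λ i → g (a +ℕ i))

  sum-scale : ∀ a n c (f : ℕ → Laurent) → sumFromTo a n (λ k → c * f k) ≃ c * sumFromTo a n f
  sum-scale a n c f = sumL-scale (suc n ∸ a) c (λ i → f (a +ℕ i))

  sum-first : ∀ a n (f : ℕ → Laurent) → a ≤ n → sumFromTo a n f ≃ f a + sumFromTo (suc a) n f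
  sum-first a n f a≤n = begin
    sumL (suc n ∸ a) g                     ≈⟨ sumL-length g (ℕ.+-∸-assoc 1 a≤n) ⟩
    sumL (suc (n ∸ a)) g                   ≈⟨ sumL-first (n ∸ a) g ⟩
    g 0 + sumL (n ∸ a) (λ i → g (suc i))   ≈⟨ +-cong (≃-reflexive (cong f (ℕ.+-identityʳ a))) (sumL-cong (n ∸ a) _ _ (λ i _ → ≃-reflexive (cong f (ℕ.+-suc a i)))) ⟩
    f a + sumFromTo (suc a) n f            ∎
    where
    g = λ i → f (a +ℕ i)

  sum-last : ∀ a n (f : ℕ → Laurent) → a ≤ suc n → sumFromTo a (suc n) f ≃ sumFromTo a n f + f (suc n)
  sum-last a n f a≤n+1 = begin
    sumL (suc (suc n) ∸ a) g              ≈⟨ sumL-length g (ℕ.+-∸-assoc 1 a≤n+1) ⟩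
    sumL (suc n ∸ a) g + g (suc n ∸ a)    ≈⟨ +-cong (≃-refl {sumL (suc n ∸ a) g}) (≃-reflexive (cong f (ℕ.m+[n∸m]≡n a≤n+1))) ⟩
    sumFromTo a n f + f (suc n)           ∎
    where
    g = λ i → f (a +ℕ i)

  sum-single : ∀ n (f : ℕ → Laurent) → sumFromTo n n f ≃ f n
  sum-single n f = begin
    sumFromTo n n f                       ≈⟨ sum-first n n f ℕ.≤-refl ⟩
    f n + sumFromTo (suc n) n f           ≈⟨ +-cong (≃-refl {f n}) (sumL-length (λ i → f (suc n +ℕ i)) (ℕ.n∸n≡0 n)) ⟩
    f n + 0#                              ≈⟨ +-identityʳ (f n) ⟩
    f n                                   ∎

  prodL-cong : ∀ s {f g : ℕ → Laurent} → (∀ j → f j ≃ g j) → prodL s f ≃ prodL s g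
  prodL-cong zero    f≃g = ≃-refl
  prodL-cong (suc s) f≃g = *-cong (prodL-cong s f≃g) (f≃g s)

  prodL-* : ∀ s (f g : ℕ → Laurent) → prodL s f * prodL s g ≃ prodL s (λ j → f j * g j)
  prodL-* zero    f g = *-identityˡ 1#
  prodL-* (suc s) f g = ≃-trans (solve 4 (λ a b c d → (a :* b) :* (c :* d) := (a :* c) :* (b :* d)) ≃-refl (prodL s f) (f s) (prodL s g) (g s))
    (*-cong (prodL-* s f g) (≃-refl {f s * g s}))

  prodL-scale : ∀ s c (f : ℕ → Laurent) → prodL s (λ j → c * f j) ≃ c ^ s * prodL s f
  prodL-scale zero    c f = ≃-sym (*-identityˡ 1#)
  prodL-scale (suc s) c f = ≃-trans (*-cong (prodL-scale s c f) (≃-refl {c * f s}))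
    (solve 4 (λ x p c y → (x :* p) :* (c :* y) := (c :* x) :* (p :* y)) ≃-refl (c ^ s) (prodL s f) c (f s))

  infix 4 _∣_
  record _∣_ (D X : Laurent) : Set where
    constructor divides
    field
      quotient : Laurent
      proof    : X ≃ D * quotient

  ∣-resp : ∀ {D X Y} → X ≃ Y → D ∣ X → D ∣ Y
  ∣-resp X≃Y (divides L X≃DL) = divides L (≃-trans (≃-sym X≃Y) X≃DL)

  ∣-+ : ∀ {D X Y} → D ∣ X → D ∣ Y → D ∣ X + Y
  ∣-+ {D} (divides L X≃DL) (divides M Y≃DM) = divides (L + M) (≃-trans (+-cong X≃DL Y≃DM) (≃-sym (distribˡ D L M)))

  ∣-scale : ∀ {D X} c → D ∣ X → D ∣ c * X
  ∣-scale {D} c (divides L X≃DL) = divides (c * L) (≃-trans (*-cong (≃-refl {c}) X≃DL)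
    (solve 3 (λ c d l → c :* (d :* l) := d :* (c :* l)) ≃-refl c D L))

  ∣-transfer : ∀ {D D′ X} C E → C * D′ ≃ D * E → D′ ∣ X → D ∣ C * X
  ∣-transfer {D} {D′} C E CD′≃DE (divides L X≃D′L) = divides (E * L) (begin
    C * _            ≈⟨ *-cong (≃-refl {C}) X≃D′L ⟩
    C * (D′ * L)     ≈⟨ *-assoc C D′ L ⟨
    C * D′ * L       ≈⟨ *-cong CD′≃DE (≃-refl {L}) ⟩
    D * E * L        ≈⟨ *-assoc D E L ⟩
    D * (E * L)      ∎)

  ∣-zero : ∀ {D} → D ∣ 0#
  ∣-zero {D} = divides 0# (≃-sym (zeroʳ D))

  ∣-unit : ∀ {D} X → D ≃ 1# → D ∣ X
  ∣-unit {D} X D≃1 = divides X (≃-sym (≃-trans (*-cong D≃1 (≃-refl {X})) (*-identityˡ X)))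

module Argument where

  open LaurentRing
  open QAnalogues
  open SumsAndDivisibility
  open import Data.Nat using (ℕ; zero; suc; _≤_; _∸_; z≤n; s≤s) renaming (_+_ to _+ℕ_; _*_ to _*ℕ_)
  import Data.Nat.Properties as ℕ
  open import Data.Nat.Tactic.RingSolver using () renaming (solve-∀ to solveℕ-∀)
  open import Data.Integer using (+_) renaming (-_ to -ℤ_)
  open import Data.Sum using (inj₁; inj₂)
  open import Data.Product using (_,_)
  open Polynomial using (_≋_)
  open import Relation.Binary.PropositionalEquality using (_≡_; refl; cong; sym; trans)
  open import Relation.Binary.Reasoning.Setoid setoid

  u : ℕ → Laurent
  u k = q^- k * [ 2 *ℕ k +ℕ 1 ]

  -- y j k = q^{-k} ([j] - [k]) [j+k+1] = (1 - q^{j-k})(1 - q^{j+k+1}) / (1 - q)²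
  y : ℕ → ℕ → Laurent
  y j k = q^- k * ([ j ] - [ k ]) * [ k +ℕ j +ℕ 1 ]

  -- R s k = y 0 k · y 1 k ⋯ y (s-1) k = (q^{-k};q)_s (q^{k+1};q)_s / (1 - q)^{2s}
  R : ℕ → ℕ → Laurent
  R s k = prodL s (λ j → y j k)

  D : ℕ → ℕ → Laurent
  D n a = [ 2 *ℕ n +ℕ 1 ] * binom (2 *ℕ n) (n ∸ a)

  T : ℕ → (ℕ → Laurent) → ℕ → Laurent
  T n f k = u k * (binom (2 *ℕ n +ℕ 1) (n ∸ k) * f k)

  -- the factor 1 - q, twice of which clears the denominator of y
  1-q : Laurent
  1-q = 1# - q

  y-factored : ∀ j k → 1-q * (1-q * y j k) ≃ (1# - q^- k * q^ j) * (1# - q^ k * q^ j * q)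
  y-factored j k = begin
    1-q * (1-q * y j k)
      ≈⟨ regroup 1-q (q^- k) [ j ] [ k ] [ k +ℕ j +ℕ 1 ] ⟩
    q^- k * (1-q * [ j ] - 1-q * [ k ]) * (1-q * [ k +ℕ j +ℕ 1 ])
      ≈⟨ *-cong (*-cong (≃-refl {q^- k}) (+-cong (geometric j) (-‿cong (geometric k))))
                (≃-trans (geometric (k +ℕ j +ℕ 1)) (+-cong (≃-refl {1#}) (-‿cong q^[k+j+1]))) ⟩
    q^- k * ((1# - q^ j) - (1# - q^ k)) * (1# - q^ k * q^ j * q)
      ≈⟨ difference (q^- k) (q^ j) (q^ k) (1# - q^ k * q^ j * q) ⟩
    (q^- k * q^ k - q^- k * q^ j) * (1# - q^ k * q^ j * q)
      ≈⟨ *-cong (+-cong (q^-inverseˡ k) (≃-refl { - (q^- k * q^ j)})) (≃-refl {1# - q^ k * q^ j * q}) ⟩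
    (1# - q^- k * q^ j) * (1# - q^ k * q^ j * q)
      ∎
    where
    q^[k+j+1] : q^ (k +ℕ j +ℕ 1) ≃ q^ k * q^ j * q
    q^[k+j+1] = ≃-trans (q^-+ (k +ℕ j) 1) (*-cong (q^-+ k j) (≃-refl {q}))
    regroup : ∀ t a b c d → t * (t * (a * (b - c) * d)) ≃ a * (t * b - t * c) * (t * d)
    regroup = solve 5 (λ t a b c d → t :* (t :* (a :* (b :- c) :* d)) := a :* (t :* b :- t :* c) :* (t :* d)) ≃-refl
    difference : ∀ a x y z → a * ((1# - x) - (1# - y)) * z ≃ (a * y - a * x) * z
    difference = solve 4 (λ a x y z → a :* ((con (+ 1) :- x) :- (con (+ 1) :- y)) :* z := (a :* y :- a :* x) :* z) ≃-refl

  y-quadratic : ∀ j k → 1-q * (1-q * y j k) ≃ 1# - (q^- k + q^ k * q) * q^ j + q * (q^ j * q^ j)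
  y-quadratic j k = begin
    1-q * (1-q * y j k)                                              ≈⟨ y-factored j k ⟩
    (1# - q^- k * q^ j) * (1# - q^ k * q^ j * q)                     ≈⟨ expand (q^- k) (q^ k) (q^ j) q ⟩
    1# - (q^- k + q^ k * q) * q^ j + (q^- k * q^ k) * q * (q^ j * q^ j)
      ≈⟨ +-cong (≃-refl {1# - (q^- k + q^ k * q) * q^ j}) (*-cong (≃-trans (*-cong (q^-inverseˡ k) (≃-refl {q})) (*-identityˡ q)) (≃-refl {q^ j * q^ j})) ⟩
    1# - (q^- k + q^ k * q) * q^ j + q * (q^ j * q^ j)               ∎
    where
    expand : ∀ P K J q → (1# - P * J) * (1# - K * J * q) ≃ 1# - (P + K * q) * J + (P * K) * q * (J * J)
    expand = solve 4 (λ P K J q → (con (+ 1) :- P :* J) :* (con (+ 1) :- K :* J :* q)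
                                  := con (+ 1) :- (P :+ K :* q) :* J :+ (P :* K) :* q :* (J :* J)) ≃-refl

  -- Changing the base point: y s k q^n = q^s (y n k - y n s).  By
  -- y-quadratic, after multiplying by (1 - q)² both sides are
  -- q^n (1 - A q^s + q (q^s)²), using only q^s q^{-s} = 1.
  y-recentre : ∀ s k n → y s k * q^ n ≃ q^ s * (y n k - y n s)
  y-recentre s k n = 1-q-cancel-≃ _ _ (1-q-cancel-≃ _ _ (begin
    1-q * (1-q * (y s k * N))
      ≈⟨ solve 3 (λ t y n → t :* (t :* (y :* n)) := (t :* (t :* y)) :* n) ≃-refl 1-q (y s k) N ⟩
    (1-q * (1-q * y s k)) * N
      ≈⟨ *-cong (y-quadratic s k) (≃-refl {N}) ⟩
    (1# - A * S + q * (S * S)) * N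
      ≈⟨ regroup A S S⁻ N q ⟩
    S * ((1# - A * N + q * (N * N)) - (1# - (S⁻ + S * q) * N + q * (N * N))) + (1# - S * S⁻) * N
      ≈⟨ +-cong (≃-refl {Z}) (*-cong (+-cong (≃-refl {1#}) (-‿cong (q^-inverse s))) (≃-refl {N})) ⟩
    Z + (1# - 1#) * N
      ≈⟨ solve 2 (λ z n → z :+ (con (+ 1) :- con (+ 1)) :* n := z) ≃-refl Z N ⟩
    Z
      ≈⟨ *-cong (≃-refl {S}) (+-cong (y-quadratic n k) (-‿cong (y-quadratic n s))) ⟨
    S * (1-q * (1-q * y n k) - 1-q * (1-q * y n s))
      ≈⟨ solve 4 (λ t s a b → t :* (t :* (s :* (a :- b))) := s :* (t :* (t :* a) :- t :* (t :* b))) ≃-refl 1-q S (y n k) (y n s) ⟨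
    1-q * (1-q * (S * (y n k - y n s)))
      ∎))
    where
    A = q^- k + q^ k * q
    S = q^ s
    S⁻ = q^- s
    N = q^ n
    Z = S * ((1# - A * N + q * (N * N)) - (1# - (S⁻ + S * q) * N + q * (N * N)))
    regroup : ∀ A S S⁻ N q → (1# - A * S + q * (S * S)) * N
      ≃ S * ((1# - A * N + q * (N * N)) - (1# - (S⁻ + S * q) * N + q * (N * N))) + (1# - S * S⁻) * N
    regroup = solve 5 (λ A S S⁻ N q → (con (+ 1) :- A :* S :+ q :* (S :* S)) :* N
      := S :* ((con (+ 1) :- A :* N :+ q :* (N :* N)) :- (con (+ 1) :- (S⁻ :+ S :* q) :* N :+ q :* (N :* N)))
         :+ (con (+ 1) :- S :* S⁻) :* N) ≃-refl

  y-recentred : ∀ s k n → y s k ≃ (q^- n * q^ s) * (y n k - y n s)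
  y-recentred s k n = begin
    y s k                             ≈⟨ *-identityʳ (y s k) ⟨
    y s k * 1#                        ≈⟨ *-cong (≃-refl {y s k}) (q^-inverse n) ⟨
    y s k * (q^ n * q^- n)            ≈⟨ *-assoc (y s k) (q^ n) (q^- n) ⟨
    (y s k * q^ n) * q^- n            ≈⟨ *-cong (y-recentre s k n) (≃-refl {q^- n}) ⟩
    (q^ s * (y n k - y n s)) * q^- n  ≈⟨ solve 3 (λ a x b → (a :* x) :* b := (b :* a) :* x) ≃-refl (q^ s) (y n k - y n s) (q^- n) ⟩
    (q^- n * q^ s) * (y n k - y n s)  ∎

  y-diagonal : ∀ k → y k k ≃ 0#
  y-diagonal k = ≃-trans (solve 3 (λ a b c → a :* (b :- b) :* c := con (+ 0)) ≃-refl (q^- k) [ k ] [ k +ℕ k +ℕ 1 ]) const-zero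

  y-above : ∀ k d → y (k +ℕ d) k ≃ [ d ] * [ k +ℕ (k +ℕ d) +ℕ 1 ]
  y-above k d = begin
    q^- k * ([ k +ℕ d ] - [ k ]) * E                ≈⟨ *-cong (*-cong (≃-refl {q^- k}) (+-cong ([+] k d) (≃-refl { - [ k ]}))) (≃-refl {E}) ⟩
    q^- k * (([ k ] + q^ k * [ d ]) - [ k ]) * E    ≈⟨ solve 5 (λ a b c x e → a :* ((b :+ c :* x) :- b) :* e := (a :* c) :* x :* e) ≃-refl (q^- k) [ k ] (q^ k) [ d ] E ⟩
    (q^- k * q^ k) * [ d ] * E                      ≈⟨ *-cong (*-cong (q^-inverseˡ k) (≃-refl {[ d ]})) (≃-refl {E}) ⟩
    1# * [ d ] * E                                  ≈⟨ *-cong (*-identityˡ [ d ]) (≃-refl {E}) ⟩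
    [ d ] * E                                       ∎
    where
    E = [ k +ℕ (k +ℕ d) +ℕ 1 ]

  -- [2m+3 brack m+1-k] · y (m+1) k = [2m+3][2m+2] [2m+1 brack m-k]  for k ≤ m:
  -- y (m+1) k = [m+1-k][m+k+2], and both factors are absorbed.
  binom-times-y : ∀ k m → k ≤ m →
    binom (2 *ℕ suc m +ℕ 1) (suc m ∸ k) * y (suc m) k ≃ ([ 2 *ℕ suc m +ℕ 1 ] * [ 2 *ℕ suc m ]) * binom (2 *ℕ m +ℕ 1) (m ∸ k)
  binom-times-y k m k≤m with m ∸ k | ℕ.m+[n∸m]≡n k≤m
  ... | d | refl = begin
    binom (2 *ℕ suc m +ℕ 1) (suc m ∸ k) * y (suc m) k
      ≈⟨ *-cong (binom-cong {m = 2 *ℕ suc m +ℕ 1} refl m+1-k) (≃-trans (≃-reflexive (cong (λ j → y j k) (sym (ℕ.+-suc k d)))) (y-above k (suc d))) ⟩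
    binom (2 *ℕ suc m +ℕ 1) (suc d) * ([ suc d ] * [ k +ℕ (k +ℕ suc d) +ℕ 1 ])
      ≈⟨ *-assoc (binom (2 *ℕ suc m +ℕ 1) (suc d)) [ suc d ] [ k +ℕ (k +ℕ suc d) +ℕ 1 ] ⟨
    binom (2 *ℕ suc m +ℕ 1) (suc d) * [ suc d ] * [ k +ℕ (k +ℕ suc d) +ℕ 1 ]
      ≈⟨ *-cong (*-cong (binom-cong {j = suc d} (top k d) refl) (≃-refl {[ suc d ]})) ([_]-cong (second k d)) ⟩
    binom (suc (suc (d +ℕ e))) (suc d) * [ suc d ] * [ suc e ]
      ≈⟨ absorb-twice d e ⟩
    [ suc (suc (d +ℕ e)) ] * [ suc (d +ℕ e) ] * binom (d +ℕ e) d
      ≈⟨ *-cong (*-cong ([_]-cong (sym (top k d))) ([_]-cong (sym (middle k d)))) (binom-cong {j = d} (sym (bottom k d)) refl) ⟩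
    ([ 2 *ℕ suc m +ℕ 1 ] * [ 2 *ℕ suc m ]) * binom (2 *ℕ m +ℕ 1) d
      ∎
    where
    e = k +ℕ (k +ℕ d) +ℕ 1
    m+1-k : suc (k +ℕ d) ∸ k ≡ suc d
    m+1-k = trans (cong (_∸ k) (sym (ℕ.+-suc k d))) (ℕ.m+n∸m≡n k (suc d))
    top : ∀ k d → 2 *ℕ suc (k +ℕ d) +ℕ 1 ≡ suc (suc (d +ℕ (k +ℕ (k +ℕ d) +ℕ 1)))
    top = solveℕ-∀
    second : ∀ k d → k +ℕ (k +ℕ suc d) +ℕ 1 ≡ suc (k +ℕ (k +ℕ d) +ℕ 1)
    second = solveℕ-∀
    middle : ∀ k d → 2 *ℕ suc (k +ℕ d) ≡ suc (d +ℕ (k +ℕ (k +ℕ d) +ℕ 1))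
    middle = solveℕ-∀
    bottom : ∀ k d → 2 *ℕ (k +ℕ d) +ℕ 1 ≡ d +ℕ (k +ℕ (k +ℕ d) +ℕ 1)
    bottom = solveℕ-∀

  D-step : ∀ a m → a ≤ m →
    ([ 2 *ℕ suc m +ℕ 1 ] * [ 2 *ℕ suc m ]) * D m a ≃ D (suc m) a * ([ suc m ∸ a ] * [ suc m +ℕ a ])
  D-step a m a≤m with m ∸ a | ℕ.m+[n∸m]≡n a≤m
  ... | d | refl = ≃-sym (begin
    [ N ] * binom (2 *ℕ suc m) (suc m ∸ a) * ([ suc m ∸ a ] * [ suc m +ℕ a ])
      ≈⟨ *-cong (*-cong (≃-refl {[ N ]}) (binom-cong {m = 2 *ℕ suc m} refl m+1-a)) (*-cong ([_]-cong m+1-a) ([_]-cong (second a d))) ⟩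
    [ N ] * binom (2 *ℕ suc m) (suc d) * ([ suc d ] * [ suc e ])
      ≈⟨ solve 4 (λ n b x z → n :* b :* (x :* z) := n :* (b :* x :* z)) ≃-refl [ N ] (binom (2 *ℕ suc m) (suc d)) [ suc d ] [ suc e ] ⟩
    [ N ] * (binom (2 *ℕ suc m) (suc d) * [ suc d ] * [ suc e ])
      ≈⟨ *-cong (≃-refl {[ N ]}) (*-cong (*-cong (binom-cong {j = suc d} (top a d) refl) (≃-refl {[ suc d ]})) (≃-refl {[ suc e ]})) ⟩
    [ N ] * (binom (suc (suc (d +ℕ e))) (suc d) * [ suc d ] * [ suc e ])
      ≈⟨ *-cong (≃-refl {[ N ]}) (absorb-twice d e) ⟩
    [ N ] * ([ suc (suc (d +ℕ e)) ] * [ suc (d +ℕ e) ] * binom (d +ℕ e) d)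
      ≈⟨ *-cong (≃-refl {[ N ]}) (*-cong (*-cong ([_]-cong (sym (top a d))) ([_]-cong (sym (middle a d)))) (binom-cong {j = d} (sym (bottom a d)) refl)) ⟩
    [ N ] * ([ 2 *ℕ suc m ] * [ 2 *ℕ m +ℕ 1 ] * binom (2 *ℕ m) d)
      ≈⟨ solve 4 (λ n n′ n″ b → n :* (n′ :* n″ :* b) := (n :* n′) :* (n″ :* b)) ≃-refl [ N ] [ 2 *ℕ suc m ] [ 2 *ℕ m +ℕ 1 ] (binom (2 *ℕ m) d) ⟩
    ([ N ] * [ 2 *ℕ suc m ]) * ([ 2 *ℕ m +ℕ 1 ] * binom (2 *ℕ m) d)
      ∎)
    where
    N = 2 *ℕ suc (a +ℕ d) +ℕ 1
    e = a +ℕ a +ℕ d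
    m+1-a : suc (a +ℕ d) ∸ a ≡ suc d
    m+1-a = trans (cong (_∸ a) (sym (ℕ.+-suc a d))) (ℕ.m+n∸m≡n a (suc d))
    second : ∀ a d → suc (a +ℕ d) +ℕ a ≡ suc (a +ℕ a +ℕ d)
    second = solveℕ-∀
    top : ∀ a d → 2 *ℕ suc (a +ℕ d) ≡ suc (suc (d +ℕ (a +ℕ a +ℕ d)))
    top = solveℕ-∀
    middle : ∀ a d → 2 *ℕ (a +ℕ d) +ℕ 1 ≡ suc (d +ℕ (a +ℕ a +ℕ d))
    middle = solveℕ-∀
    bottom : ∀ a d → 2 *ℕ (a +ℕ d) ≡ d +ℕ (a +ℕ a +ℕ d)
    bottom = solveℕ-∀

  -- The summands of the case s = 0 telescope: for n = a + d + 1,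
  -- u a [2n+1 brack n-a] = q^{-n} ([2n+1][2n brack d+1] - [2n+1][2n brack d]).
  telescoping-term : ∀ a d → let n = a +ℕ suc d in
    u a * binom (2 *ℕ n +ℕ 1) (n ∸ a)
      ≃ q^- n * ([ 2 *ℕ n +ℕ 1 ] * binom (2 *ℕ n) (suc d) - [ 2 *ℕ n +ℕ 1 ] * binom (2 *ℕ n) d)
  telescoping-term a d = ≃-sym (begin
    q^- n * ([ N ] * binom (2 *ℕ n) (suc d) - [ N ] * binom (2 *ℕ n) d)
      ≈⟨ *-cong (≃-refl {q^- n}) (+-cong upper (-‿cong lower)) ⟩
    q^- n * (B * [ suc d +ℕ suc (a +ℕ a) ] - B * [ suc d ])
      ≈⟨ *-cong (≃-refl {q^- n}) (+-cong (*-cong (≃-refl {B}) ([+] (suc d) (suc (a +ℕ a)))) (≃-refl { - (B * [ suc d ])})) ⟩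
    q^- n * (B * ([ suc d ] + q^ suc d * [ suc (a +ℕ a) ]) - B * [ suc d ])
      ≈⟨ solve 5 (λ Q B c S x → Q :* (B :* (c :+ S :* x) :- B :* c) := Q :* S :* x :* B) ≃-refl (q^- n) B [ suc d ] (q^ suc d) [ suc (a +ℕ a) ] ⟩
    q^- n * q^ suc d * [ suc (a +ℕ a) ] * B
      ≈⟨ *-cong (*-cong (*-cong (q^--+ a (suc d)) (≃-refl {q^ suc d})) ([_]-cong (2a+1 a))) (binom-cong {m = N} refl (sym (ℕ.m+n∸m≡n a (suc d)))) ⟩
    q^- a * q^- suc d * q^ suc d * [ 2 *ℕ a +ℕ 1 ] * binom N (n ∸ a)
      ≈⟨ solve 5 (λ A D S x b → A :* D :* S :* x :* b := (D :* S) :* ((A :* x) :* b)) ≃-refl (q^- a) (q^- suc d) (q^ suc d) [ 2 *ℕ a +ℕ 1 ] (binom N (n ∸ a)) ⟩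
    (q^- suc d * q^ suc d) * (u a * binom N (n ∸ a))
      ≈⟨ *-cong (q^-inverseˡ (suc d)) (≃-refl {u a * binom N (n ∸ a)}) ⟩
    1# * (u a * binom N (n ∸ a))
      ≈⟨ *-identityˡ (u a * binom N (n ∸ a)) ⟩
    u a * binom N (n ∸ a)
      ∎)
    where
    n = a +ℕ suc d
    N = 2 *ℕ n +ℕ 1
    B = binom N (suc d)
    up₁ : ∀ a d → 2 *ℕ (a +ℕ suc d) +ℕ 1 ≡ suc (suc d +ℕ suc (a +ℕ a +ℕ d))
    up₁ = solveℕ-∀
    up₂ : ∀ a d → suc d +ℕ suc (a +ℕ a) ≡ suc (suc (a +ℕ a +ℕ d))
    up₂ = solveℕ-∀
    up₃ : ∀ a d → 2 *ℕ (a +ℕ suc d) ≡ suc d +ℕ suc (a +ℕ a +ℕ d)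
    up₃ = solveℕ-∀
    low₁ : ∀ a d → 2 *ℕ (a +ℕ suc d) +ℕ 1 ≡ suc (d +ℕ suc (suc (a +ℕ a +ℕ d)))
    low₁ = solveℕ-∀
    low₂ : ∀ a d → 2 *ℕ (a +ℕ suc d) ≡ d +ℕ suc (suc (a +ℕ a +ℕ d))
    low₂ = solveℕ-∀
    2a+1 : ∀ a → suc (a +ℕ a) ≡ 2 *ℕ a +ℕ 1
    2a+1 = solveℕ-∀
    upper : [ N ] * binom (2 *ℕ n) (suc d) ≃ B * [ suc d +ℕ suc (a +ℕ a) ]
    upper = ≃-sym (begin
      B * [ suc d +ℕ suc (a +ℕ a) ]                       ≈⟨ *-cong (binom-cong {j = suc d} (up₁ a d) refl) ([_]-cong (up₂ a d)) ⟩
      binom (suc (suc d +ℕ g)) (suc d) * [ suc g ]        ≈⟨ absorb-bottom (suc d) g ⟩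
      [ suc (suc d +ℕ g) ] * binom (suc d +ℕ g) (suc d)   ≈⟨ *-cong ([_]-cong (sym (up₁ a d))) (binom-cong {j = suc d} (sym (up₃ a d)) refl) ⟩
      [ N ] * binom (2 *ℕ n) (suc d)                      ∎)
      where
      g = suc (a +ℕ a +ℕ d)
    lower : [ N ] * binom (2 *ℕ n) d ≃ B * [ suc d ]
    lower = ≃-sym (begin
      B * [ suc d ]                                       ≈⟨ *-cong (binom-cong {j = suc d} (low₁ a d) refl) (≃-refl {[ suc d ]}) ⟩
      binom (suc (d +ℕ g)) (suc d) * [ suc d ]            ≈⟨ absorb-top d g ⟩
      [ suc (d +ℕ g) ] * binom (d +ℕ g) d                 ≈⟨ *-cong ([_]-cong (sym (low₁ a d))) (binom-cong {j = d} (sym (low₂ a d)) refl) ⟩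
      [ N ] * binom (2 *ℕ n) d                            ∎)
      where
      g = suc (suc (a +ℕ a +ℕ d))

  Admissible : (ℕ → Laurent) → Set
  Admissible f = ∀ n a → a ≤ n → D n a ∣ sumFromTo a n (T n f)

  admissible-cong : ∀ {f g} → (∀ k → f k ≃ g k) → Admissible f → Admissible g
  admissible-cong {f} {g} f≃g f-adm n a a≤n =
    ∣-resp (sum-cong a n (T n f) (T n g) (λ k _ _ → *-cong (≃-refl {u k}) (*-cong (≃-refl {binom (2 *ℕ n +ℕ 1) (n ∸ k)}) (f≃g k))))
           (f-adm n a a≤n)

  admissible-combination : ∀ c d f g → Admissible f → Admissible g → Admissible (λ k → c * f k + d * g k)
  admissible-combination c d f g f-adm g-adm n a a≤n =
    ∣-resp (≃-sym split) (∣-+ (∣-scale c (f-adm n a a≤n)) (∣-scale d (g-adm n a a≤n)))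
    where
    split : sumFromTo a n (T n (λ k → c * f k + d * g k)) ≃ c * sumFromTo a n (T n f) + d * sumFromTo a n (T n g)
    split = ≃-trans (sum-cong a n _ _ (λ k _ _ → solve 6 (λ u b c f d g → u :* (b :* (c :* f :+ d :* g)) := c :* (u :* (b :* f)) :+ d :* (u :* (b :* g))) ≃-refl (u k) (binom (2 *ℕ n +ℕ 1) (n ∸ k)) c (f k) d (g k)))
            (≃-trans (sum-+ a n (λ k → c * T n f k) (λ k → d * T n g k)) (+-cong (sum-scale a n c (T n f)) (sum-scale a n d (T n g))))

  telescoped-sum : ∀ d a n → a +ℕ d ≡ n → sumFromTo a n (T n (R 0)) ≃ q^- n * ([ 2 *ℕ n +ℕ 1 ] * binom (2 *ℕ n) d)
  telescoped-sum zero a n a+0≡n with trans (sym (ℕ.+-identityʳ a)) a+0≡n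
  ... | refl = begin
    sumFromTo a a (T a (R 0))                         ≈⟨ sum-single a (T a (R 0)) ⟩
    q^- a * [ N ] * (binom N (a ∸ a) * 1#)            ≈⟨ *-cong (≃-refl {q^- a * [ N ]}) (≃-trans (*-identityʳ (binom N (a ∸ a))) (≃-trans (binom-cong {m = N} refl (ℕ.n∸n≡0 a)) (binom-zero N))) ⟩
    q^- a * [ N ] * 1#                                ≈⟨ solve 2 (λ x y → x :* y :* con (+ 1) := x :* (y :* con (+ 1))) ≃-refl (q^- a) [ N ] ⟩
    q^- a * ([ N ] * 1#)                              ≈⟨ *-cong (≃-refl {q^- a}) (*-cong (≃-refl {[ N ]}) (binom-zero (2 *ℕ a))) ⟨
    q^- a * ([ N ] * binom (2 *ℕ a) 0)                ∎
    where
    N = 2 *ℕ a +ℕ 1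
  telescoped-sum (suc d) a .(a +ℕ suc d) refl = begin
    sumFromTo a n (T n (R 0))
      ≈⟨ sum-first a n (T n (R 0)) (ℕ.m≤m+n a (suc d)) ⟩
    T n (R 0) a + sumFromTo (suc a) n (T n (R 0))
      ≈⟨ +-cong (≃-trans (*-cong (≃-refl {u a}) (*-identityʳ (binom N (n ∸ a)))) (telescoping-term a d))
                (telescoped-sum d (suc a) n (sym (ℕ.+-suc a d))) ⟩
    q^- n * ([ N ] * binom (2 *ℕ n) (suc d) - [ N ] * binom (2 *ℕ n) d) + q^- n * ([ N ] * binom (2 *ℕ n) d)
      ≈⟨ solve 3 (λ Q x y → Q :* (x :- y) :+ Q :* y := Q :* x) ≃-refl (q^- n) ([ N ] * binom (2 *ℕ n) (suc d)) ([ N ] * binom (2 *ℕ n) d) ⟩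
    q^- n * ([ N ] * binom (2 *ℕ n) (suc d))
      ∎
    where
    n = a +ℕ suc d
    N = 2 *ℕ n +ℕ 1

  R₀-admissible : Admissible (R 0)
  R₀-admissible n a a≤n = divides (q^- n)
    (≃-trans (telescoped-sum (n ∸ a) a n (ℕ.m+[n∸m]≡n a≤n)) (*-comm (q^- n) (D n a)))

  top-vanishes : ∀ s n → T n (λ k → y n k * R s k) n ≃ 0#
  top-vanishes s n = begin
    u n * (B * (y n n * R s n))    ≈⟨ *-cong (≃-refl {u n}) (*-cong (≃-refl {B}) (*-cong (y-diagonal n) (≃-refl {R s n}))) ⟩
    u n * (B * (0# * R s n))       ≈⟨ *-cong (≃-refl {u n}) (*-cong (≃-refl {B}) (zeroˡ (R s n))) ⟩
    u n * (B * 0#)                 ≈⟨ *-cong (≃-refl {u n}) (zeroʳ B) ⟩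
    u n * 0#                       ≈⟨ zeroʳ (u n) ⟩
    0#                             ∎
    where
    B = binom (2 *ℕ n +ℕ 1) (n ∸ n)

  -- Multiplying the weight R s by y n k, where n is the upper limit of
  -- the sum, lowers n by one at the cost of the factor [2n+1][2n],
  -- which D-step absorbs into the modulus.
  y-weighted-admissible : ∀ s → Admissible (R s) → ∀ n a → a ≤ n → D n a ∣ sumFromTo a n (T n (λ k → y n k * R s k))
  y-weighted-admissible s R-adm n a a≤n with ℕ.m≤n⇒m<n∨m≡n a≤n
  ... | inj₂ refl = ∣-resp (≃-sym (≃-trans (sum-single n (T n (λ k → y n k * R s k))) (top-vanishes s n))) ∣-zero
  y-weighted-admissible s R-adm (suc m) a a≤n | inj₁ (s≤s a≤m) =
    ∣-resp (≃-sym lowered) (∣-transfer C ([ suc m ∸ a ] * [ suc m +ℕ a ]) (D-step a m a≤m) (R-adm m a a≤m))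
    where
    n = suc m
    C = [ 2 *ℕ n +ℕ 1 ] * [ 2 *ℕ n ]
    summand : ∀ k → a ≤ k → k ≤ m → T n (λ k → y n k * R s k) k ≃ C * T m (R s) k
    summand k _ k≤m = begin
      u k * (binom (2 *ℕ n +ℕ 1) (n ∸ k) * (y n k * R s k))   ≈⟨ *-cong (≃-refl {u k}) (*-assoc (binom (2 *ℕ n +ℕ 1) (n ∸ k)) (y n k) (R s k)) ⟨
      u k * (binom (2 *ℕ n +ℕ 1) (n ∸ k) * y n k * R s k)     ≈⟨ *-cong (≃-refl {u k}) (*-cong (binom-times-y k m k≤m) (≃-refl {R s k})) ⟩
      u k * (C * binom (2 *ℕ m +ℕ 1) (m ∸ k) * R s k)         ≈⟨ solve 4 (λ u C b r → u :* (C :* b :* r) := C :* (u :* (b :* r))) ≃-refl (u k) C (binom (2 *ℕ m +ℕ 1) (m ∸ k)) (R s k) ⟩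
      C * T m (R s) k                                         ∎
    lowered : sumFromTo a n (T n (λ k → y n k * R s k)) ≃ C * sumFromTo a m (T m (R s))
    lowered = begin
      sumFromTo a n (T n (λ k → y n k * R s k))                                  ≈⟨ sum-last a m (T n (λ k → y n k * R s k)) a≤n ⟩
      sumFromTo a m (T n (λ k → y n k * R s k)) + T n (λ k → y n k * R s k) n    ≈⟨ +-cong (sum-cong a m (T n (λ k → y n k * R s k)) (λ k → C * T m (R s) k) summand) (top-vanishes s n) ⟩
      sumFromTo a m (λ k → C * T m (R s) k) + 0#                                 ≈⟨ +-identityʳ (sumFromTo a m (λ k → C * T m (R s) k)) ⟩
      sumFromTo a m (λ k → C * T m (R s) k)                                      ≈⟨ sum-scale a m C (T m (R s)) ⟩
      C * sumFromTo a m (T m (R s))                                              ∎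

  -- The weights R s are admissible, by induction on s: recentring
  -- y s k at the upper limit n writes R (s+1) as a combination of
  -- y n k · R s k and R s k.
  R-admissible : ∀ s → Admissible (R s)
  R-admissible zero = R₀-admissible
  R-admissible (suc s) zero    .0 z≤n = ∣-unit _ ≃-refl
  R-admissible (suc s) (suc m) a a≤n =
    ∣-resp (≃-sym split) (∣-+ (∣-scale c (y-weighted-admissible s (R-admissible s) n a a≤n)) (∣-scale (- (c * e)) (R-admissible s n a a≤n)))
    where
    n = suc m
    c = q^- n * q^ s
    e = y n s
    summand : ∀ k → T n (R (suc s)) k ≃ c * T n (λ k → y n k * R s k) k + - (c * e) * T n (R s) k
    summand k = begin
      u k * (B * (R s k * y s k))                                     ≈⟨ *-cong (≃-refl {u k}) (*-cong (≃-refl {B}) (*-cong (≃-refl {R s k}) (y-recentred s k n))) ⟩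
      u k * (B * (R s k * (c * (y n k - e))))                         ≈⟨ solve 6 (λ u b r c y e → u :* (b :* (r :* (c :* (y :- e)))) := c :* (u :* (b :* (y :* r))) :+ :- (c :* e) :* (u :* (b :* r))) ≃-refl (u k) B (R s k) c (y n k) e ⟩
      c * (u k * (B * (y n k * R s k))) + - (c * e) * T n (R s) k     ∎
      where
      B = binom (2 *ℕ n +ℕ 1) (n ∸ k)
    split : sumFromTo a n (T n (R (suc s))) ≃ c * sumFromTo a n (T n (λ k → y n k * R s k)) + - (c * e) * sumFromTo a n (T n (R s))
    split = ≃-trans (sum-cong a n _ _ (λ k _ _ → summand k))
            (≃-trans (sum-+ a n (λ k → c * T n (λ k → y n k * R s k) k) (λ k → - (c * e) * T n (R s) k))
            (+-cong (sum-scale a n c (T n (λ k → y n k * R s k))) (sum-scale a n (- (c * e)) (T n (R s)))))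

  u-scaled : ∀ k → 1-q * u k ≃ q^- k - q^ k * q
  u-scaled k = begin
    1-q * (q^- k * [ 2 *ℕ k +ℕ 1 ])      ≈⟨ solve 3 (λ t p x → t :* (p :* x) := p :* (t :* x)) ≃-refl 1-q (q^- k) [ 2 *ℕ k +ℕ 1 ] ⟩
    q^- k * (1-q * [ 2 *ℕ k +ℕ 1 ])      ≈⟨ *-cong (≃-refl {q^- k}) (geometric (2 *ℕ k +ℕ 1)) ⟩
    q^- k * (1# - q^ (2 *ℕ k +ℕ 1))      ≈⟨ *-cong (≃-refl {q^- k}) (+-cong (≃-refl {1#}) (-‿cong q^[2k+1])) ⟩
    q^- k * (1# - q^ k * q^ k * q)       ≈⟨ solve 3 (λ p K q → p :* (con (+ 1) :- K :* K :* q) := p :- (p :* K) :* (K :* q)) ≃-refl (q^- k) (q^ k) q ⟩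
    q^- k - (q^- k * q^ k) * (q^ k * q)  ≈⟨ +-cong (≃-refl {q^- k}) (-‿cong (≃-trans (*-cong (q^-inverseˡ k) (≃-refl {q^ k * q})) (*-identityˡ (q^ k * q)))) ⟩
    q^- k - q^ k * q                     ∎
    where
    2k+1 : ∀ k → 2 *ℕ k +ℕ 1 ≡ k +ℕ k +ℕ 1
    2k+1 = solveℕ-∀
    q^[2k+1] : q^ (2 *ℕ k +ℕ 1) ≃ q^ k * q^ k * q
    q^[2k+1] = ≃-trans (≃-reflexive (cong q^_ (2k+1 k))) (≃-trans (q^-+ (k +ℕ k) 1) (*-cong (q^-+ k k) (≃-refl {q})))

  -- With A = q^{-k} + q^{k+1}, both sides times (1 - q)² equal A² - 4q,
  -- by u-scaled and y-quadratic.
  u²-expansion : ∀ k → u k * u k ≃ 1# - (1# + 1#) * (1# + q) * y 0 k + (1-q * 1-q) * (y 0 k * y 0 k)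
  u²-expansion k = 1-q-cancel-≃ _ _ (1-q-cancel-≃ _ _ (begin
    1-q * (1-q * (u k * u k))
      ≈⟨ solve 2 (λ t x → t :* (t :* (x :* x)) := (t :* x) :* (t :* x)) ≃-refl 1-q (u k) ⟩
    (1-q * u k) * (1-q * u k)
      ≈⟨ *-cong (u-scaled k) (u-scaled k) ⟩
    (P - M) * (P - M)
      ≈⟨ solve 2 (λ P M → (P :- M) :* (P :- M) := (P :+ M) :* (P :+ M) :- (con (+ 1) :+ con (+ 1)) :* (con (+ 1) :+ con (+ 1)) :* (P :* M)) ≃-refl P M ⟩
    A * A - (1# + 1#) * (1# + 1#) * (P * M)
      ≈⟨ +-cong (≃-refl {A * A}) (-‿cong (*-cong (≃-refl {(1# + 1#) * (1# + 1#)}) PM)) ⟩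
    A * A - (1# + 1#) * (1# + 1#) * q
      ≈⟨ solve 2 (λ A q → A :* A :- (con (+ 1) :+ con (+ 1)) :* (con (+ 1) :+ con (+ 1)) :* q
                        := (con (+ 1) :- q) :* (con (+ 1) :- q) :- (con (+ 1) :+ con (+ 1)) :* (con (+ 1) :+ q) :* (con (+ 1) :- A :* con (+ 1) :+ q :* (con (+ 1) :* con (+ 1)))
                           :+ (con (+ 1) :- A :* con (+ 1) :+ q :* (con (+ 1) :* con (+ 1))) :* (con (+ 1) :- A :* con (+ 1) :+ q :* (con (+ 1) :* con (+ 1)))) ≃-refl A q ⟩
    1-q * 1-q - t * Y + Y * Y
      ≈⟨ +-cong (+-cong (≃-refl {1-q * 1-q}) (-‿cong (*-cong (≃-refl {t}) Y≃))) (*-cong Y≃ Y≃) ⟩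
    1-q * 1-q - t * (1-q * (1-q * y 0 k)) + (1-q * (1-q * y 0 k)) * (1-q * (1-q * y 0 k))
      ≈⟨ solve 3 (λ s t y → s :* s :- t :* (s :* (s :* y)) :+ (s :* (s :* y)) :* (s :* (s :* y))
                        := s :* (s :* (con (+ 1) :- t :* y :+ (s :* s) :* (y :* y)))) ≃-refl 1-q t (y 0 k) ⟩
    1-q * (1-q * (1# - t * y 0 k + (1-q * 1-q) * (y 0 k * y 0 k)))
      ∎))
    where
    P = q^- k
    M = q^ k * q
    A = P + M
    t = (1# + 1#) * (1# + q)
    -- y-quadratic at j = 0, where q^0 is 1
    Y = 1# - A * 1# + q * (1# * 1#)
    Y≃ : Y ≃ 1-q * (1-q * y 0 k)
    Y≃ = ≃-sym (y-quadratic 0 k)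
    PM : P * M ≃ q
    PM = ≃-trans (≃-sym (*-assoc P (q^ k) q)) (≃-trans (*-cong (q^-inverseˡ k) (≃-refl {q})) (*-identityˡ q))

  AdmissibleFamily : (ℕ → Laurent) → Set
  AdmissibleFamily g = ∀ s → Admissible (λ k → g k * R s k)

  -- y 0 k R s k is a combination of R (s+1) k and R s k with
  -- coefficients independent of k (recentre y 0 k at s).
  family-y₀ : ∀ g → AdmissibleFamily g → AdmissibleFamily (λ k → g k * y 0 k)
  family-y₀ g g-adm s = admissible-cong rearrange
    (admissible-combination c (- (c * e)) (λ k → g k * R (suc s) k) (λ k → g k * R s k) (g-adm (suc s)) (g-adm s))
    where
    c = q^- s * q^ 0
    e = y s 0
    rearrange : ∀ k → c * (g k * R (suc s) k) + - (c * e) * (g k * R s k) ≃ g k * y 0 k * R s k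
    rearrange k = ≃-sym (begin
      g k * y 0 k * R s k                                      ≈⟨ *-cong (*-cong (≃-refl {g k}) (y-recentred 0 k s)) (≃-refl {R s k}) ⟩
      g k * (c * (y s k - e)) * R s k                          ≈⟨ solve 5 (λ g c y e r → g :* (c :* (y :- e)) :* r := c :* (g :* (r :* y)) :+ :- (c :* e) :* (g :* r)) ≃-refl (g k) c (y s k) e (R s k) ⟩
      c * (g k * R (suc s) k) + - (c * e) * (g k * R s k)      ∎)

  family-u² : ∀ g → AdmissibleFamily g → AdmissibleFamily (λ k → g k * (u k * u k))
  family-u² g g-adm s = admissible-cong rearrange
    (admissible-combination 1# (1-q * 1-q) (λ k → 1# * (g k * R s k) + - t * (g k * y 0 k * R s k)) (λ k → g k * y 0 k * y 0 k * R s k)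
      (admissible-combination 1# (- t) (λ k → g k * R s k) (λ k → g k * y 0 k * R s k) (g-adm s) (family-y₀ g g-adm s))
      (family-y₀ (λ k → g k * y 0 k) (family-y₀ g g-adm) s))
    where
    t = (1# + 1#) * (1# + q)
    rearrange : ∀ k → 1# * (1# * (g k * R s k) + - t * (g k * y 0 k * R s k)) + 1-q * 1-q * (g k * y 0 k * y 0 k * R s k)
                      ≃ g k * (u k * u k) * R s k
    rearrange k = ≃-sym (begin
      g k * (u k * u k) * R s k
        ≈⟨ *-cong (*-cong (≃-refl {g k}) (u²-expansion k)) (≃-refl {R s k}) ⟩
      g k * (1# - t * y 0 k + (1-q * 1-q) * (y 0 k * y 0 k)) * R s k
        ≈⟨ solve 5 (λ g t w y r → g :* (con (+ 1) :- t :* y :+ w :* (y :* y)) :* r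
                    := con (+ 1) :* (con (+ 1) :* (g :* r) :+ :- t :* (g :* y :* r)) :+ w :* (g :* y :* y :* r)) ≃-refl (g k) t (1-q * 1-q) (y 0 k) (R s k) ⟩
      1# * (1# * (g k * R s k) + - t * (g k * y 0 k * R s k)) + 1-q * 1-q * (g k * y 0 k * y 0 k * R s k)
        ∎)

  family-u²-powers : ∀ r → AdmissibleFamily (λ k → (u k * u k) ^ r)
  family-u²-powers zero    s = admissible-cong (λ k → ≃-sym (*-identityˡ (R s k))) (R-admissible s)
  family-u²-powers (suc r) s = admissible-cong (λ k → *-cong (*-comm ((u k * u k) ^ r) (u k * u k)) (≃-refl {R s k}))
    (family-u² (λ k → (u k * u k) ^ r) (family-u²-powers r) s)

  pochhammers : ∀ s k → qPoch (qPow (-ℤ (+ k))) s * qPoch (qPow (+ (k +ℕ 1))) s ≃ (1-q * 1-q) ^ s * R s k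
  pochhammers s k = ≃-trans (prodL-* s _ _) (≃-trans (prodL-cong s factor) (prodL-scale s (1-q * 1-q) (λ j → y j k)))
    where
    factor : ∀ j → (1# - qPow (-ℤ (+ k)) * q^ j) * (1# - q^ (k +ℕ 1) * q^ j) ≃ 1-q * 1-q * y j k
    factor j = begin
      (1# - qPow (-ℤ (+ k)) * q^ j) * (1# - q^ (k +ℕ 1) * q^ j)
        ≈⟨ *-cong (+-cong (≃-refl {1#}) (-‿cong (*-cong (qPow-negative k) (≃-refl {q^ j}))))
                  (+-cong (≃-refl {1#}) (-‿cong (≃-trans (*-cong (q^-+ k 1) (≃-refl {q^ j})) (solve 3 (λ a b c → (a :* b) :* c := a :* c :* b) ≃-refl (q^ k) q (q^ j))))) ⟩
      (1# - q^- k * q^ j) * (1# - q^ k * q^ j * q)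
        ≈⟨ y-factored j k ⟨
      1-q * (1-q * y j k)
        ≈⟨ *-assoc 1-q 1-q (y j k) ⟨
      1-q * 1-q * y j k
        ∎

  odd-power : ∀ x r → x ^ (2 *ℕ r +ℕ 1) ≃ x * (x * x) ^ r
  odd-power x r = begin
    x ^ (2 *ℕ r +ℕ 1)      ≈⟨ ≃-reflexive (cong (x ^_) (2r+1 r)) ⟩
    x * x ^ (r +ℕ r)       ≈⟨ *-cong (≃-refl {x}) (^-homo-* x r r) ⟩
    x * (x ^ r * x ^ r)    ≈⟨ *-cong (≃-refl {x}) (^-distrib-* x x r) ⟨
    x * (x * x) ^ r        ∎
    where
    2r+1 : ∀ r → 2 *ℕ r +ℕ 1 ≡ suc (r +ℕ r)
    2r+1 = solveℕ-∀

  summand : ℕ → ℕ → ℕ → ℕ → Laurent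
  summand n r s k =
    qPow (-ℤ (+ ((2 *ℕ r +ℕ 1) *ℕ k)))
      *L (fromPoly (powP (qInt (2 *ℕ k +ℕ 1)) (2 *ℕ r +ℕ 1))
      *L (fromPoly (qBin (2 *ℕ n +ℕ 1) (n ∸ k))
      *L (qPoch (qPow (-ℤ (+ k))) s
      *L qPoch (qPow (+ (k +ℕ 1))) s)))

  -- The summand is (1 - q)^{2s} times the summand with weight (u k²)^r R s k,
  -- because q^{-(2r+1)k}[2k+1]^{2r+1} = u^{2r+1} = u (u²)^r.
  summand-normal-form : ∀ n r s k → summand n r s k ≃ (1-q * 1-q) ^ s * T n (λ k → (u k * u k) ^ r * R s k) k
  summand-normal-form n r s k = begin
    qPow (-ℤ (+ (e *ℕ k))) * (fromPoly (powP (qInt (2 *ℕ k +ℕ 1)) e) * (B * (Pochhammers)))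
      ≈⟨ *-cong (≃-trans (qPow-negative (e *ℕ k)) (q^-* e k)) (*-cong (fromPoly-powP (qInt (2 *ℕ k +ℕ 1)) e) (*-cong (≃-refl {B}) (pochhammers s k))) ⟩
    (q^- k) ^ e * ([ 2 *ℕ k +ℕ 1 ] ^ e * (B * (W * R s k)))
      ≈⟨ solve 5 (λ a b c w r → a :* (b :* (c :* (w :* r))) := w :* ((a :* b) :* (c :* r))) ≃-refl ((q^- k) ^ e) ([ 2 *ℕ k +ℕ 1 ] ^ e) B W (R s k) ⟩
    W * (((q^- k) ^ e * [ 2 *ℕ k +ℕ 1 ] ^ e) * (B * R s k))
      ≈⟨ *-cong (≃-refl {W}) (*-cong (≃-trans (≃-sym (^-distrib-* (q^- k) [ 2 *ℕ k +ℕ 1 ] e)) (odd-power (u k) r)) (≃-refl {B * R s k})) ⟩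
    W * ((u k * (u k * u k) ^ r) * (B * R s k))
      ≈⟨ *-cong (≃-refl {W}) (solve 4 (λ u z b r → (u :* z) :* (b :* r) := u :* (b :* (z :* r))) ≃-refl (u k) ((u k * u k) ^ r) B (R s k)) ⟩
    W * T n (λ k → (u k * u k) ^ r * R s k) k
      ∎
    where
    e = 2 *ℕ r +ℕ 1
    B = binom (2 *ℕ n +ℕ 1) (n ∸ k)
    W = (1-q * 1-q) ^ s
    Pochhammers = qPoch (qPow (-ℤ (+ k))) s * qPoch (qPow (+ (k +ℕ 1))) s

  sum-normal-form : ∀ n a r s →
    sumFromTo a n (summand n r s) ≃ (1-q * 1-q) ^ s * sumFromTo a n (T n (λ k → (u k * u k) ^ r * R s k))
  sum-normal-form n a r s =
    ≃-trans (sum-cong a n (summand n r s) (λ k → (1-q * 1-q) ^ s * T n (λ k → (u k * u k) ^ r * R s k) k) (λ k _ _ → summand-normal-form n r s k))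
            (sum-scale a n ((1-q * 1-q) ^ s) (T n (λ k → (u k * u k) ^ r * R s k)))

  ∣⇒DividesL : ∀ n a X → D n a ∣ X → DividesL (mulP (qInt (2 *ℕ n +ℕ 1)) (qBin (2 *ℕ n) (n ∸ a))) X
  ∣⇒DividesL n a X (divides L X≃DL) = L , _≋_.at (atL X≃DL)

open import Data.Nat using (ℕ; _≤_; _∸_; _+_; _*_)
open import Data.Integer using (-_; +_)
open LaurentRing using (≃-sym) renaming (_*_ to _·_)
open QAnalogues using (_^_)
open SumsAndDivisibility using (∣-resp; ∣-scale)
open Argument

-- Lemma 5.2: the sum is (1 - q)^{2s} times the admissible sum with weight
-- (u k²)^r R s k, hence divisible by [2n+1][2n brack n-a].
lemma5p2 : (n a r s : ℕ) → 1 ≤ n → a ≤ n →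
    DividesL (mulP (qInt (2 * n + 1)) (qBin (2 * n) (n ∸ a)))
      (sumFromTo a n (λ k →
        qPow (- (+ ((2 * r + 1) * k)))
        *L (fromPoly (powP (qInt (2 * k + 1)) (2 * r + 1))
        *L (fromPoly (qBin (2 * n + 1) (n ∸ k))
        *L (qPoch (qPow (- (+ k))) s
        *L qPoch (qPow (+ (k + 1))) s)))))
lemma5p2 n a r s _ a≤n = ∣⇒DividesL n a (sumFromTo a n (summand n r s))
  (∣-resp (≃-sym (sum-normal-form n a r s)) (∣-scale ((1-q · 1-q) ^ s) (family-u²-powers r s n a a≤n)))
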